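{- Let $r\ge 2$, let $k$ be an integer with $0\le k\le r-1$, and let $G$ be a finite $(r+1)$-partite $r$-graph in which every partite $(r-1)$-tuple of vertices has strictly balanced degree. If $\max_j\sum_{i\ne j}\rho(i)>r-k-1$, then $G$ contains a copy of $K_{r+1}^r-k$.
   Context: An $r$-graph is an $r$-uniform hypergraph (unweighted). It is $(r+1)$-partite with classes $V_1,\ldots,V_{r+1}$ if every edge has at most one vertex in each class. $P_i$ is the $r$-partite $r$-graph induced by the classes $V_j$, $j\ne i$, and $\rho(i)=|E(P_i)|/\prod_{j\ne i}|V_j|$. A set of vertices is partite if it has at most one vertex in each class. For a partite $(r-1)$-tuple $g$ and a class $V_i$ not meeting $g$, $d(V_i,g)$ is the number of $v\in V_i$ with $g\cup\{v\}\in E(G)$; $g$ has strictly balanced degree if $d(V_i,g)=d(V_j,g)$ for the two classes $V_i,V_j$ not meeting $g$. $K_{r+1}^r$ is the complete $r$-graph on $r+1$ vertices, and $K_{r+1}^r-k$ is the $r$-graph obtained from $K_{r+1}^r$ by deleting any $k$ of its edges (all choices give isomorphic $r$-graphs). -}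

module Defs where

open import Data.Nat using (ℕ; zero; suc; _*_; _∸_; _≤_)
open import Data.Bool using (Bool; true; false; _∧_; _∨_; not; if_then_else_)
open import Data.Fin using (Fin; toℕ; _≟_)
open import Data.Fin.Subset using () renaming (⊥ to ∅)
open import Data.Fin.Subset using (Subset; _∈_; _∉_; ∣_∣; ⁅_⁆; _∪_; ∁; inside; outside)
open import Data.Vec using (Vec; []; _∷_; lookup)
open import Data.List using (List; []; _∷_; map; _++_; filter; length; foldr; allFin)
open import Data.Integer using (+_)
open import Data.Rational using (ℚ; _/_; 0ℚ; _+_)
open import Relation.Nullary using (does; ¬_)
open import Relation.Binary.PropositionalEquality using (_≡_)
open import Data.Product using (∃; _×_; Σ)
open import Function.Definitions using (Injective)

mem : ∀ {n} → Fin n → Subset n → Bool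
mem x p with lookup p x
... | inside = true
... | outside = false

allSubsets : (n : ℕ) → List (Subset n)
allSubsets zero = [] ∷ []
allSubsets (suc n) = map (inside ∷_) (allSubsets n) ++ map (outside ∷_) (allSubsets n)

countL : ∀ {A : Set} → (A → Bool) → List A → ℕ
countL p xs = length (filter (λ x → Data.Bool._≟_ (p x) true) xs)

prodL : List ℕ → ℕ
prodL = foldr _*_ 1

sumℚ : List ℚ → ℚ
sumℚ = foldr _+_ 0ℚ

-- a / d as a rational, for natural d (value 0 when d = 0; never used then,
-- since the theorem assumes all classes nonempty).
_÷ℕ_ : ℕ → ℕ → ℚ
a ÷ℕ zero = 0ℚ
a ÷ℕ suc d = (+ a) / suc d

-- Vertices are Fin N; vertex x lies in class
-- cls x (classes V_1..V_{r+1} are indexed by Fin (suc r)); edges are given by a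
-- Boolean indicator on vertex subsets; every edge has exactly r vertices and
-- at most one vertex in each class.
record PartiteGraph (r : ℕ) : Set where
  field
    N       : ℕ
    cls     : Fin N → Fin (suc r)
    edge    : Subset N → Bool
    uniform : ∀ e → edge e ≡ true → ∣ e ∣ ≡ r
    partite : ∀ e → edge e ≡ true →
              ∀ x y → x ∈ e → y ∈ e → cls x ≡ cls y → x ≡ y

module _ {r : ℕ} (G : PartiteGraph r) where
  open PartiteGraph G

  inClass : Fin N → Fin (suc r) → Bool
  inClass x i = does (cls x ≟ i)

  classSize : Fin (suc r) → ℕ
  classSize i = countL (λ x → inClass x i) (allFin N)

  IsPartite : Subset N → Set
  IsPartite g = ∀ x y → x ∈ g → y ∈ g → cls x ≡ cls y → x ≡ y

  Avoids : Subset N → Fin (suc r) → Set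
  Avoids g i = ∀ x → x ∈ g → ¬ (cls x ≡ i)

  avoids? : Subset N → Fin (suc r) → Bool
  avoids? g i = not (foldr _∨_ false (map (λ x → mem x g ∧ inClass x i) (allFin N)))

  deg : Fin (suc r) → Subset N → ℕ
  deg i g = countL (λ v → inClass v i ∧ edge (g ∪ ⁅ v ⁆)) (allFin N)

  StrictlyBalanced : Set
  StrictlyBalanced = ∀ (g : Subset N) → ∣ g ∣ ≡ r ∸ 1 → IsPartite g →
    ∀ i j → Avoids g i → Avoids g j → deg i g ≡ deg j g

  edgesP : Fin (suc r) → ℕ
  edgesP i = countL (λ e → edge e ∧ avoids? e i) (allSubsets N)

  prodOthers : Fin (suc r) → ℕ
  prodOthers i = prodL (map classSize (filter (λ j → Data.Bool._≟_ (not (does (j ≟ i))) true) (allFin (suc r))))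

  ρ : Fin (suc r) → ℚ
  ρ i = edgesP i ÷ℕ prodOthers i

  sumρExcept : Fin (suc r) → ℚ
  sumρExcept j = sumℚ (map ρ (filter (λ i → Data.Bool._≟_ (not (does (i ≟ j))) true) (allFin (suc r))))

-- K_{r+1}^r - k on vertex set Fin (suc r): the edges of K_{r+1}^r are the
-- complements of singletons; we delete the k edges ∁ ⁅ m ⁆ with toℕ m < k.
KminusEdge : (r k : ℕ) → Subset (suc r) → Set
KminusEdge r k e = Σ (Fin (suc r)) (λ m → (k ≤ toℕ m) × (e ≡ ∁ ⁅ m ⁆))

image : ∀ {m n} → (Fin m → Fin n) → Subset m → Subset n
image f e = foldr _∪_ ∅ (map (λ a → if mem a e then ⁅ f a ⁆ else ∅) (allFin _))

ContainsKminus : ∀ {r} → PartiteGraph r → ℕ → Set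
ContainsKminus {r} G k =
  ∃ λ (f : Fin (suc r) → Fin (PartiteGraph.N G)) → Injective _≡_ _≡_ f ×
    (∀ e → KminusEdge r k e → PartiteGraph.edge G (image f e) ≡ true)

-- Work with transversals x = (x_c)_c, x_c ∈ V_c, of which there are
-- P = Π_c |V_c|, and let E_c(x) ∈ {0, 1} record whether the face x − x_c is
-- an edge; write e_c = |E(P_c)|.
--  (1) Every edge of P_c is the face opposite c of |V_c| transversals, so
--      Σ_x E_c(x) = |V_c| e_c.
--  (2) For i ≠ j, D_ij(x) = Σ_{u ∈ V_i} E_j(x with x_i := u) is the degree of
--      the ridge x − {x_i, x_j} into V_i.  Strict balance gives D_ij = D_ji,
--      and summing over x yields e_i = e_j: all ρ(i) are e |V_i| / P.
--  (3) Cauchy–Schwarz for D_ij gives |V_i| |V_j| e² ≤ P · #{x : E_i(x) = E_j(x) = 1}.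
--  (4) Summing (3) over i ≠ j and comparing with (1) for c = j, the hypothesis
--      produces a transversal with E_j(x) = 1 and at least r − k further
--      edge faces, i.e. at most k faces that are not edges.
--  (5) Ordering its vertices so that the missing faces lie opposite the first
--      k vertices of K_{r+1}^r embeds K_{r+1}^r − k.
module Submission where

open import Defs
open import Data.Nat using (ℕ; _≤_; _∸_; NonZero)
open import Data.Integer using (+_)
open import Data.Rational using (_<_; _/_)
open import Data.Product using (∃)

open import Data.Nat as N using (zero; suc; _+_; _*_; z≤n; s≤s)
open import Data.Nat.Properties hiding (_≟_; suc-injective)
open import Data.Nat.Tactic.RingSolver using (solve-∀)
open import Data.Bool as B using (Bool; true; false; _∧_; _∨_; not; if_then_else_)
import Data.Bool.Properties as BP
open import Data.Fin as F using (Fin; zero; suc)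
open import Data.Fin.Properties as FP using (suc-injective)
open import Data.Fin.Subset as S using (Subset; ⁅_⁆; ∁; _∪_; _∩_; _∈_)
open import Data.Vec as V using (Vec; []; _∷_; lookup; insertAt; _[_]≔_)
import Data.Vec.Properties as VP
open import Data.List using (List; []; _∷_; map; _++_; filter; foldr; allFin)
import Data.List.Properties as LP
open import Data.List.Relation.Unary.Any using (Any; here; there)
open import Data.List.Membership.Propositional.Properties using (∈-allFin)
open import Data.Product using (Σ; _×_; _,_; proj₁; proj₂; swap)
open import Data.Sum using (_⊎_; inj₁; inj₂)
open import Data.Empty using (⊥; ⊥-elim)
open import Relation.Nullary using (Dec; yes; no; does; ¬_)
open import Relation.Nullary.Decidable using (_×-dec_)
open import Relation.Binary.PropositionalEquality
open import Relation.Binary.Definitions using (DecidableEquality)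
open import Function.Definitions using (Injective)
open import Data.Integer as Z using (+<+)
import Data.Integer.Properties as ZP
import Data.Integer.Tactic.RingSolver as ZR
open import Data.Rational using (toℚᵘ)
import Data.Rational.Properties as QP
open import Data.Rational.Unnormalised as U using (mkℚᵘ; *≡*; *<*)
import Data.Rational.Unnormalised.Properties as UP

sumL : ∀ {A : Set} → (A → ℕ) → List A → ℕ
sumL f []       = 0
sumL f (x ∷ xs) = f x + sumL f xs

module _ {A : Set} where
  sumL-cong : ∀ {f g : A → ℕ} → (∀ x → f x ≡ g x) → ∀ xs → sumL f xs ≡ sumL g xs
  sumL-cong f≗g []       = refl
  sumL-cong f≗g (x ∷ xs) = cong₂ _+_ (f≗g x) (sumL-cong f≗g xs)

  sumL-+ : ∀ (f g : A → ℕ) xs → sumL (λ x → f x + g x) xs ≡ sumL f xs + sumL g xs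
  sumL-+ f g []       = refl
  sumL-+ f g (x ∷ xs) rewrite sumL-+ f g xs = interchange (f x) (g x) (sumL f xs) (sumL g xs)
    where
    interchange : ∀ a b c d → (a + b) + (c + d) ≡ (a + c) + (b + d)
    interchange = solve-∀

  sumL-*ˡ : ∀ c (f : A → ℕ) xs → sumL (λ x → c * f x) xs ≡ c * sumL f xs
  sumL-*ˡ c f []       = sym (*-zeroʳ c)
  sumL-*ˡ c f (x ∷ xs) rewrite sumL-*ˡ c f xs = sym (*-distribˡ-+ c (f x) (sumL f xs))

  sumL-*ʳ : ∀ c (f : A → ℕ) xs → sumL (λ x → f x * c) xs ≡ sumL f xs * c
  sumL-*ʳ c f xs = trans (sumL-cong (λ x → *-comm (f x) c) xs) (trans (sumL-*ˡ c f xs) (*-comm c _))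

  sumL-++ : ∀ (f : A → ℕ) xs ys → sumL f (xs ++ ys) ≡ sumL f xs + sumL f ys
  sumL-++ f []       ys = refl
  sumL-++ f (x ∷ xs) ys rewrite sumL-++ f xs ys = sym (+-assoc (f x) _ _)

  sumL-mono : ∀ {f g : A → ℕ} → (∀ x → f x ≤ g x) → ∀ xs → sumL f xs ≤ sumL g xs
  sumL-mono f≤g []       = z≤n
  sumL-mono f≤g (x ∷ xs) = +-mono-≤ (f≤g x) (sumL-mono f≤g xs)

  sumL-zero : ∀ xs → sumL (λ (_ : A) → 0) xs ≡ 0
  sumL-zero []       = refl
  sumL-zero (x ∷ xs) = sumL-zero xs

  larger-term : ∀ (f g : A → ℕ) xs → sumL g xs N.< sumL f xs → Σ A λ x → g x N.< f x
  larger-term f g []       ()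
  larger-term f g (x ∷ xs) lt with g x N.<? f x
  ... | yes gx<fx = x , gx<fx
  ... | no  gx≮fx = larger-term f g xs (+-cancelˡ-< (f x) _ _ (≤-<-trans (+-monoˡ-≤ _ (≮⇒≥ gx≮fx)) lt))

  positive-term : ∀ (f : A → ℕ) xs → 0 N.< sumL f xs → Σ A λ x → 0 N.< f x
  positive-term f xs pos = larger-term f (λ _ → 0) xs (subst (N._< sumL f xs) (sym (sumL-zero xs)) pos)

sumL-map : ∀ {A B : Set} (f : B → ℕ) (g : A → B) xs → sumL f (map g xs) ≡ sumL (λ x → f (g x)) xs
sumL-map f g []       = refl
sumL-map f g (x ∷ xs) = cong (_+_ (f (g x))) (sumL-map f g xs)

sumL-swap : ∀ {A B : Set} (f : A → B → ℕ) xs ys →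
  sumL (λ x → sumL (f x) ys) xs ≡ sumL (λ y → sumL (λ x → f x y) xs) ys
sumL-swap f []       ys = sym (sumL-zero ys)
sumL-swap f (x ∷ xs) ys = begin
    sumL (f x) ys + sumL (λ x → sumL (f x) ys) xs
  ≡⟨ cong (_+_ (sumL (f x) ys)) (sumL-swap f xs ys) ⟩
    sumL (f x) ys + sumL (λ y → sumL (λ x → f x y) xs) ys
  ≡⟨ sym (sumL-+ (f x) (λ y → sumL (λ x → f x y) xs) ys) ⟩
    sumL (λ y → f x y + sumL (λ x → f x y) xs) ys ∎
  where open ≡-Reasoning

allFin-suc : ∀ n → allFin (suc n) ≡ zero ∷ map suc (allFin n)
allFin-suc n = cong (zero ∷_) (sym (LP.map-tabulate (λ i → i) suc))

sumFin-suc : ∀ n (f : Fin (suc n) → ℕ) → sumL f (allFin (suc n)) ≡ f zero + sumL (λ i → f (suc i)) (allFin n)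
sumFin-suc n f = trans (cong (sumL f) (allFin-suc n)) (cong (_+_ (f zero)) (sumL-map f suc (allFin n)))

sumFin-const : ∀ n → sumL (λ (_ : Fin n) → 1) (allFin n) ≡ n
sumFin-const zero    = refl
sumFin-const (suc n) = trans (sumFin-suc n (λ _ → 1)) (cong suc (sumFin-const n))

⟦_⟧ : Bool → ℕ
⟦ true  ⟧ = 1
⟦ false ⟧ = 0

⟦∧⟧ : ∀ a b → ⟦ a ∧ b ⟧ ≡ ⟦ a ⟧ * ⟦ b ⟧
⟦∧⟧ true  b = sym (+-identityʳ ⟦ b ⟧)
⟦∧⟧ false b = refl

⟦⟧² : ∀ a → ⟦ a ⟧ * ⟦ a ⟧ ≡ ⟦ a ⟧
⟦⟧² true  = refl
⟦⟧² false = refl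

⟦not⟧ : ∀ a → ⟦ a ⟧ + ⟦ not a ⟧ ≡ 1
⟦not⟧ true  = refl
⟦not⟧ false = refl

indicators-< : ∀ a b m s → ⟦ a ⟧ * ⟦ b ⟧ * m N.< ⟦ a ⟧ * (⟦ b ⟧ * s) → a ≡ true × b ≡ true × m N.< s
indicators-< true true m s m<s = refl , refl , subst₂ N._<_ (+-identityʳ m) (trans (+-identityʳ (s + 0)) (+-identityʳ s)) m<s

countL≡sumL : ∀ {A : Set} (p : A → Bool) xs → countL p xs ≡ sumL (λ x → ⟦ p x ⟧) xs
countL≡sumL p []       = refl
countL≡sumL p (x ∷ xs) with p x
... | true  = cong suc (countL≡sumL p xs)
... | false = countL≡sumL p xs

dec-true : ∀ {P : Set} (p? : Dec P) → does p? ≡ true → P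
dec-true (yes p) _ = p

dec-true⁻ : ∀ {P : Set} (p? : Dec P) → P → does p? ≡ true
dec-true⁻ (yes p) _ = refl
dec-true⁻ (no ¬p) p = ⊥-elim (¬p p)

dec-false : ∀ {P : Set} (p? : Dec P) → ¬ P → does p? ≡ false
dec-false (yes p) ¬p = ⊥-elim (¬p p)
dec-false (no _)  _  = refl

does-⇔ : ∀ {P Q : Set} (p? : Dec P) (q? : Dec Q) → (P → Q) → (Q → P) → does p? ≡ does q?
does-⇔ (yes p) (yes q) f g = refl
does-⇔ (yes p) (no ¬q) f g = ⊥-elim (¬q (f p))
does-⇔ (no ¬p) (yes q) f g = ⊥-elim (¬p (g q))
does-⇔ (no ¬p) (no ¬q) f g = refl

⟦⟧-× : ∀ {P Q R : Set} (r? : Dec R) (p? : Dec P) (q? : Dec Q) → (R → P × Q) → (P → Q → R) →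
  ⟦ does r? ⟧ ≡ ⟦ does p? ⟧ * ⟦ does q? ⟧
⟦⟧-× (yes r) (yes p) (yes q) f g = refl
⟦⟧-× (yes r) (yes p) (no ¬q) f g = ⊥-elim (¬q (proj₂ (f r)))
⟦⟧-× (yes r) (no ¬p) q?      f g = ⊥-elim (¬p (proj₁ (f r)))
⟦⟧-× (no ¬r) (yes p) (yes q) f g = ⊥-elim (¬r (g p q))
⟦⟧-× (no ¬r) (yes p) (no ¬q) f g = refl
⟦⟧-× (no ¬r) (no ¬p) q?      f g = refl

⟦⟧-*-cong : ∀ {P : Set} (p? : Dec P) {a b : ℕ} → (P → a ≡ b) → ⟦ does p? ⟧ * a ≡ ⟦ does p? ⟧ * b
⟦⟧-*-cong (yes p) a≡b = cong (1 *_) (a≡b p)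
⟦⟧-*-cong (no _)  a≡b = refl

EnumeratesOnce : ∀ {A : Set} → DecidableEquality A → List A → Set
EnumeratesOnce {A} _≟_ xs = ∀ (a : A) → sumL (λ x → ⟦ does (x ≟ a) ⟧) xs ≡ 1

sum-pick : ∀ {A : Set} (_≟_ : DecidableEquality A) {xs} → EnumeratesOnce _≟_ xs →
  ∀ (g : A → ℕ) a → sumL (λ x → ⟦ does (x ≟ a) ⟧ * g x) xs ≡ g a
sum-pick {A} _≟_ {xs} once g a = begin
    sumL (λ x → ⟦ does (x ≟ a) ⟧ * g x) xs
  ≡⟨ sumL-cong only-a xs ⟩
    sumL (λ x → ⟦ does (x ≟ a) ⟧ * g a) xs
  ≡⟨ sumL-*ʳ (g a) (λ x → ⟦ does (x ≟ a) ⟧) xs ⟩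
    sumL (λ x → ⟦ does (x ≟ a) ⟧) xs * g a
  ≡⟨ cong (_* g a) (once a) ⟩
    1 * g a
  ≡⟨ *-identityˡ (g a) ⟩
    g a ∎
  where
  open ≡-Reasoning
  only-a : ∀ x → ⟦ does (x ≟ a) ⟧ * g x ≡ ⟦ does (x ≟ a) ⟧ * g a
  only-a x = ⟦⟧-*-cong (x ≟ a) (cong g)

allFin-once : ∀ n → EnumeratesOnce F._≟_ (allFin n)
allFin-once (suc n) zero = begin
    sumL (λ u → ⟦ does (u F.≟ zero) ⟧) (allFin (suc n))
  ≡⟨ sumFin-suc n (λ u → ⟦ does (u F.≟ zero) ⟧) ⟩
    1 + sumL (λ u → ⟦ does (suc u F.≟ zero) ⟧) (allFin n)
  ≡⟨ cong suc (trans (sumL-cong (λ u → cong ⟦_⟧ (dec-false (suc u F.≟ zero) (λ ()))) (allFin n)) (sumL-zero (allFin n))) ⟩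
    1 ∎
  where open ≡-Reasoning
allFin-once (suc n) (suc a) = begin
    sumL (λ u → ⟦ does (u F.≟ suc a) ⟧) (allFin (suc n))
  ≡⟨ sumFin-suc n (λ u → ⟦ does (u F.≟ suc a) ⟧) ⟩
    0 + sumL (λ u → ⟦ does (suc u F.≟ suc a) ⟧) (allFin n)
  ≡⟨ sumL-cong (λ u → cong ⟦_⟧ (does-⇔ (suc u F.≟ suc a) (u F.≟ a) suc-injective (cong suc))) (allFin n) ⟩
    sumL (λ u → ⟦ does (u F.≟ a) ⟧) (allFin n)
  ≡⟨ allFin-once n a ⟩
    1 ∎
  where open ≡-Reasoning

sum-pickFin : ∀ n (g : Fin n → ℕ) a → sumL (λ u → ⟦ does (u F.≟ a) ⟧ * g u) (allFin n) ≡ g a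
sum-pickFin n = sum-pick F._≟_ {allFin n} (allFin-once n)

-- The Cauchy–Schwarz inequality over ℕ, (Σ u v)² ≤ (Σ u²)(Σ v²), by induction
-- on the list; the inductive step is the two-term AM–GM inequality.

four-mul≤square : ∀ x y → 4 * (x * y) ≤ (x + y) * (x + y)
four-mul≤square x y with ≤-total x y
... | inj₁ x≤y = subst (λ y → 4 * (x * y) ≤ (x + y) * (x + y)) (m+[n∸m]≡n x≤y)
                   (subst (4 * (x * (x + (y ∸ x))) ≤_) (expand x (y ∸ x)) (m≤m+n _ _))
  where
  expand : ∀ x d → 4 * (x * (x + d)) + d * d ≡ (x + (x + d)) * (x + (x + d))
  expand = solve-∀
... | inj₂ y≤x = subst (λ x → 4 * (x * y) ≤ (x + y) * (x + y)) (m+[n∸m]≡n y≤x)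
                   (subst (4 * ((y + (x ∸ y)) * y) ≤_) (expand y (x ∸ y)) (m≤m+n _ _))
  where
  expand : ∀ y d → 4 * ((y + d) * y) + d * d ≡ ((y + d) + y) * ((y + d) + y)
  expand = solve-∀

am-gm : ∀ x y z → z * z ≤ x * y → 2 * z ≤ x + y
am-gm x y z z²≤xy = ^2-cancel (begin
    (2 * z) * (2 * z)   ≡⟨ four-times z ⟩
    4 * (z * z)         ≤⟨ *-monoʳ-≤ 4 z²≤xy ⟩
    4 * (x * y)         ≤⟨ four-mul≤square x y ⟩
    (x + y) * (x + y)   ∎)
  where
  open ≤-Reasoning
  four-times : ∀ z → (2 * z) * (2 * z) ≡ 4 * (z * z)
  four-times = solve-∀
  ^2-cancel : ∀ {a b} → b * b ≤ a * a → b ≤ a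
  ^2-cancel {a} {b} b²≤a² with b N.≤? a
  ... | yes b≤a = b≤a
  ... | no  b≰a = let a<b = ≰⇒> b≰a in ⊥-elim (<⇒≱ (*-mono-< a<b a<b) b²≤a²)

cauchy-schwarz-step : ∀ u v U V S → S * S ≤ U * V →
  (u * v + S) * (u * v + S) ≤ (u * u + U) * (v * v + V)
cauchy-schwarz-step u v U V S S²≤UV = begin
    (u * v + S) * (u * v + S)
  ≡⟨ lhs u v S ⟩
    (u * u) * (v * v) + (2 * ((u * v) * S) + S * S)
  ≤⟨ +-monoʳ-≤ ((u * u) * (v * v)) (+-mono-≤ cross S²≤UV) ⟩
    (u * u) * (v * v) + (((u * u) * V + U * (v * v)) + U * V)
  ≡⟨ rhs u v U V ⟩
    (u * u + U) * (v * v + V) ∎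
  where
  open ≤-Reasoning
  lhs : ∀ u v S → (u * v + S) * (u * v + S) ≡ (u * u) * (v * v) + (2 * ((u * v) * S) + S * S)
  lhs = solve-∀
  rhs : ∀ u v U V → (u * u) * (v * v) + (((u * u) * V + U * (v * v)) + U * V) ≡ (u * u + U) * (v * v + V)
  rhs = solve-∀
  square : ∀ u v S → ((u * v) * S) * ((u * v) * S) ≡ (S * S) * ((u * v) * (u * v))
  square = solve-∀
  product : ∀ u v U V → (U * V) * ((u * v) * (u * v)) ≡ ((u * u) * V) * (U * (v * v))
  product = solve-∀
  cross : 2 * ((u * v) * S) ≤ (u * u) * V + U * (v * v)
  cross = am-gm ((u * u) * V) (U * (v * v)) ((u * v) * S)
    (≤-trans (≤-reflexive (square u v S)) (≤-trans (*-monoˡ-≤ _ S²≤UV) (≤-reflexive (product u v U V))))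

cauchy-schwarz : ∀ {A : Set} (u v : A → ℕ) xs →
  sumL (λ x → u x * v x) xs * sumL (λ x → u x * v x) xs ≤ sumL (λ x → u x * u x) xs * sumL (λ x → v x * v x) xs
cauchy-schwarz u v []       = z≤n
cauchy-schwarz u v (x ∷ xs) = cauchy-schwarz-step (u x) (v x) _ _ _ (cauchy-schwarz u v xs)

module VecEnumeration {A : Set} (as : List A) where

  prefixAll : ∀ {m} → List A → List (Vec A m) → List (Vec A (suc m))
  prefixAll []       ys = []
  prefixAll (u ∷ us) ys = map (u ∷_) ys ++ prefixAll us ys

  allVecs : ∀ m → List (Vec A m)
  allVecs zero    = [] ∷ []
  allVecs (suc m) = prefixAll as (allVecs m)

  sum-prefixAll : ∀ {m} (F : Vec A (suc m) → ℕ) us ys →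
    sumL F (prefixAll us ys) ≡ sumL (λ u → sumL (λ y → F (u ∷ y)) ys) us
  sum-prefixAll F []       ys = refl
  sum-prefixAll F (u ∷ us) ys =
    trans (sumL-++ F (map (u ∷_) ys) _) (cong₂ _+_ (sumL-map F (u ∷_) ys) (sum-prefixAll F us ys))

  sumVec-suc : ∀ m (F : Vec A (suc m) → ℕ) →
    sumL F (allVecs (suc m)) ≡ sumL (λ u → sumL (λ y → F (u ∷ y)) (allVecs m)) as
  sumVec-suc m F = sum-prefixAll F as (allVecs m)

  sumVec-insertAt : ∀ m (i : Fin (suc m)) (F : Vec A (suc m) → ℕ) →
    sumL F (allVecs (suc m)) ≡ sumL (λ v → sumL (λ y → F (insertAt y i v)) (allVecs m)) as
  sumVec-insertAt m       zero    F = sumVec-suc m F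
  sumVec-insertAt (suc m) (suc i) F = begin
      sumL F (allVecs (suc (suc m)))
    ≡⟨ sumVec-suc (suc m) F ⟩
      sumL (λ a → sumL (λ z → F (a ∷ z)) (allVecs (suc m))) as
    ≡⟨ sumL-cong (λ a → sumVec-insertAt m i (λ z → F (a ∷ z))) as ⟩
      sumL (λ a → sumL (λ v → sumL (λ y → F (a ∷ insertAt y i v)) (allVecs m)) as) as
    ≡⟨ sumL-swap (λ a v → sumL (λ y → F (a ∷ insertAt y i v)) (allVecs m)) as as ⟩
      sumL (λ v → sumL (λ a → sumL (λ y → F (a ∷ insertAt y i v)) (allVecs m)) as) as
    ≡⟨ sumL-cong (λ v → sym (sumVec-suc m (λ z → F (insertAt z (suc i) v)))) as ⟩
      sumL (λ v → sumL (λ y → F (insertAt y (suc i) v)) (allVecs (suc m))) as ∎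
    where open ≡-Reasoning

  allVecs-once : (_≟_ : DecidableEquality A) → EnumeratesOnce _≟_ as →
    ∀ m → EnumeratesOnce (VP.≡-dec _≟_) (allVecs m)
  allVecs-once _≟_ once zero    []         = refl
  allVecs-once _≟_ once (suc m) (a₀ ∷ y₀) = begin
      sumL (λ y → ⟦ does (y ≟V (a₀ ∷ y₀)) ⟧) (allVecs (suc m))
    ≡⟨ sumVec-suc m (λ y → ⟦ does (y ≟V (a₀ ∷ y₀)) ⟧) ⟩
      sumL (λ a → sumL (λ y → ⟦ does ((a ∷ y) ≟V (a₀ ∷ y₀)) ⟧) (allVecs m)) as
    ≡⟨ sumL-cong (λ a → trans (sumL-cong (λ y → head-tail a y) (allVecs m))
                              (sumL-*ˡ ⟦ does (a ≟ a₀) ⟧ (λ y → ⟦ does (y ≟V y₀) ⟧) (allVecs m))) as ⟩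
      sumL (λ a → ⟦ does (a ≟ a₀) ⟧ * sumL (λ y → ⟦ does (y ≟V y₀) ⟧) (allVecs m)) as
    ≡⟨ sum-pick _≟_ {as} once (λ _ → sumL (λ y → ⟦ does (y ≟V y₀) ⟧) (allVecs m)) a₀ ⟩
      sumL (λ y → ⟦ does (y ≟V y₀) ⟧) (allVecs m)
    ≡⟨ allVecs-once _≟_ once m y₀ ⟩
      1 ∎
    where
    open ≡-Reasoning
    _≟V_ : ∀ {k} → DecidableEquality (Vec A k)
    _≟V_ = VP.≡-dec _≟_
    head-tail : ∀ a y → ⟦ does ((a ∷ y) ≟V (a₀ ∷ y₀)) ⟧ ≡ ⟦ does (a ≟ a₀) ⟧ * ⟦ does (y ≟V y₀) ⟧
    head-tail a y = ⟦⟧-× ((a ∷ y) ≟V (a₀ ∷ y₀)) (a ≟ a₀) (y ≟V y₀) (λ { refl → refl , refl }) (cong₂ _∷_)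

_≟S_ : ∀ {n} → DecidableEquality (Subset n)
_≟S_ = VP.≡-dec B._≟_

allSubsets≡allVecs : ∀ n → allSubsets n ≡ VecEnumeration.allVecs (true ∷ false ∷ []) n
allSubsets≡allVecs zero    = refl
allSubsets≡allVecs (suc n) rewrite allSubsets≡allVecs n =
  cong (map (true ∷_) vecs ++_) (sym (LP.++-identityʳ (map (false ∷_) vecs)))
  where vecs = VecEnumeration.allVecs (true ∷ false ∷ []) n

allSubsets-once : ∀ n → EnumeratesOnce _≟S_ (allSubsets n)
allSubsets-once n = subst (EnumeratesOnce _≟S_) (sym (allSubsets≡allVecs n))
  (VecEnumeration.allVecs-once (true ∷ false ∷ []) B._≟_ bool-once n)
  where
  bool-once : EnumeratesOnce B._≟_ (true ∷ false ∷ [])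
  bool-once true  = refl
  bool-once false = refl

∨-true : ∀ a b → a ∨ b ≡ true → a ≡ true ⊎ b ≡ true
∨-true true  b _ = inj₁ refl
∨-true false b e = inj₂ e

∧-true : ∀ a b → a ∧ b ≡ true → a ≡ true × b ≡ true
∧-true true true _ = refl , refl

true≢false : true ≢ false
true≢false ()

not-true : ∀ b → not b ≡ true → b ≡ false
not-true false _ = refl

bool-ext : ∀ a b → (a ≡ true → b ≡ true) → (b ≡ true → a ≡ true) → a ≡ b
bool-ext true  b     f g = sym (f refl)
bool-ext false true  f g = g refl
bool-ext false false f g = refl

⟦∨⟧ : ∀ a b → (a ≡ true → b ≡ false) → ⟦ a ∨ b ⟧ ≡ ⟦ a ⟧ + ⟦ b ⟧
⟦∨⟧ true  b disjoint rewrite disjoint refl = refl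
⟦∨⟧ false b disjoint = refl

vec-ext : ∀ {A : Set} {n} (x y : Vec A n) → (∀ i → lookup x i ≡ lookup y i) → x ≡ y
vec-ext x y x≗y = trans (sym (VP.tabulate∘lookup x)) (trans (VP.tabulate-cong x≗y) (VP.tabulate∘lookup y))

subset-ext : ∀ {n} (p q : Subset n) → (∀ v → lookup p v ≡ true → lookup q v ≡ true) →
  (∀ v → lookup q v ≡ true → lookup p v ≡ true) → p ≡ q
subset-ext p q p⊆q q⊆p = vec-ext p q (λ v → bool-ext _ _ (p⊆q v) (q⊆p v))

lookup-∪ : ∀ {n} (p q : Subset n) i → lookup (p ∪ q) i ≡ lookup p i ∨ lookup q i
lookup-∪ p q i = VP.lookup-zipWith _∨_ i p q

lookup-∩ : ∀ {n} (p q : Subset n) i → lookup (p ∩ q) i ≡ lookup p i ∧ lookup q i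
lookup-∩ p q i = VP.lookup-zipWith _∧_ i p q

lookup-∅ : ∀ {n} (i : Fin n) → lookup (S.⊥ {n}) i ≡ false
lookup-∅ i = VP.lookup-replicate i false

∅-empty : ∀ {n} (i : Fin n) → lookup (S.⊥ {n}) i ≢ true
∅-empty i e = true≢false (trans (sym e) (lookup-∅ i))

lookup-⁅⁆ : ∀ {n} (u i : Fin n) → lookup ⁅ u ⁆ i ≡ does (i F.≟ u)
lookup-⁅⁆ zero    zero    = refl
lookup-⁅⁆ zero    (suc i) = lookup-∅ i
lookup-⁅⁆ (suc u) zero    = refl
lookup-⁅⁆ (suc u) (suc i) with i F.≟ u | lookup-⁅⁆ u i
... | yes _ | e = e
... | no  _ | e = e

lookup-⁅⁆-true : ∀ {n} (u i : Fin n) → lookup ⁅ u ⁆ i ≡ true → i ≡ u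
lookup-⁅⁆-true u i e = dec-true (i F.≟ u) (trans (sym (lookup-⁅⁆ u i)) e)

lookup-∁⁅⁆ : ∀ {n} (c a : Fin n) → lookup (∁ ⁅ c ⁆) a ≡ not (does (a F.≟ c))
lookup-∁⁅⁆ c a = trans (VP.lookup-map a not ⁅ c ⁆) (cong not (lookup-⁅⁆ c a))

∁⁅⁆-true : ∀ {n} (c a : Fin n) → a ≢ c → lookup (∁ ⁅ c ⁆) a ≡ true
∁⁅⁆-true c a a≢c = trans (lookup-∁⁅⁆ c a) (cong not (dec-false (a F.≟ c) a≢c))

∁⁅⁆-true⁻ : ∀ {n} (c a : Fin n) → lookup (∁ ⁅ c ⁆) a ≡ true → a ≢ c
∁⁅⁆-true⁻ c a h refl = true≢false (trans (sym h) (trans (lookup-∁⁅⁆ c a) (cong not (dec-true⁻ (a F.≟ a) refl))))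

mem≡lookup : ∀ {n} (x : Fin n) p → mem x p ≡ lookup p x
mem≡lookup x p with lookup p x
... | true  = refl
... | false = refl

∈⇒lookup : ∀ {n} {x : Fin n} {p} → x ∈ p → lookup p x ≡ true
∈⇒lookup = VP.[]=⇒lookup

lookup⇒∈ : ∀ {n} {x : Fin n} {p} → lookup p x ≡ true → x ∈ p
lookup⇒∈ {x = x} {p} = VP.lookup⇒[]= x p

size≡sum : ∀ {n} (p : Subset n) → S.∣ p ∣ ≡ sumL (λ v → ⟦ lookup p v ⟧) (allFin n)
size≡sum []                = refl
size≡sum {suc n} (true ∷ p)  = trans (cong suc (size≡sum p)) (sym (sumFin-suc n (λ v → ⟦ lookup (true ∷ p) v ⟧)))
size≡sum {suc n} (false ∷ p) = trans (size≡sum p) (sym (sumFin-suc n (λ v → ⟦ lookup (false ∷ p) v ⟧)))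

count-atMostOne : ∀ n (p : Fin n → Bool) → (∀ v w → p v ≡ true → p w ≡ true → v ≡ w) →
  sumL (λ v → ⟦ p v ⟧) (allFin n) ≤ 1
count-atMostOne zero    p unique = z≤n
count-atMostOne (suc n) p unique =
  subst (_≤ 1) (sym (sumFin-suc n (λ v → ⟦ p v ⟧))) (split (p zero) refl)
  where
  split : ∀ b → p zero ≡ b → ⟦ b ⟧ + sumL (λ i → ⟦ p (suc i) ⟧) (allFin n) ≤ 1
  split true  p0 = subst (λ t → 1 + t ≤ 1) (sym rest-zero) ≤-refl
    where
    others-false : ∀ i → p (suc i) ≡ false
    others-false i with p (suc i) in psi
    ... | true  = ⊥-elim (FP.0≢1+n (unique zero (suc i) p0 psi))
    ... | false = refl
    rest-zero : sumL (λ i → ⟦ p (suc i) ⟧) (allFin n) ≡ 0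
    rest-zero = trans (sumL-cong (λ i → cong ⟦_⟧ (others-false i)) (allFin n)) (sumL-zero (allFin n))
  split false _  = count-atMostOne n (λ i → p (suc i)) (λ v w pv pw → suc-injective (unique (suc v) (suc w) pv pw))

⋃ : ∀ {m n} → (Fin m → Subset n) → List (Fin m) → Subset n
⋃ h as = foldr _∪_ S.⊥ (map h as)

⋃-⇒ : ∀ {m n} (h : Fin m → Subset n) as v → lookup (⋃ h as) v ≡ true → Σ (Fin m) λ a → lookup (h a) v ≡ true
⋃-⇒ h []       v e = ⊥-elim (∅-empty v e)
⋃-⇒ h (a ∷ as) v e with ∨-true _ _ (trans (sym (lookup-∪ (h a) (⋃ h as) v)) e)
... | inj₁ p = a , p
... | inj₂ p = ⋃-⇒ h as v p

⋃-⇐ : ∀ {m n} (h : Fin m → Subset n) as v a → Any (a ≡_) as → lookup (h a) v ≡ true → lookup (⋃ h as) v ≡ true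
⋃-⇐ h (b ∷ as) v a (here refl) e = trans (lookup-∪ (h a) (⋃ h as) v) (cong (_∨ _) e)
⋃-⇐ h (b ∷ as) v a (there k)   e =
  trans (lookup-∪ (h b) (⋃ h as) v) (trans (cong (lookup (h b) v ∨_) (⋃-⇐ h as v a k e)) (BP.∨-zeroʳ _))

module _ {m n} (f : Fin m → Fin n) (e : Subset m) where
  private
    piece : Fin m → Subset n
    piece a = if mem a e then ⁅ f a ⁆ else S.⊥

    piece-⇒ : ∀ a v → lookup (piece a) v ≡ true → lookup e a ≡ true × f a ≡ v
    piece-⇒ a v h with mem a e | mem≡lookup a e
    ... | true  | ea = sym ea , sym (lookup-⁅⁆-true (f a) v h)
    ... | false | _  = ⊥-elim (∅-empty v h)

    piece-⇐ : ∀ a → lookup e a ≡ true → lookup (piece a) (f a) ≡ true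
    piece-⇐ a ea with mem a e | mem≡lookup a e
    ... | true  | _   = trans (lookup-⁅⁆ (f a) (f a)) (dec-true⁻ (f a F.≟ f a) refl)
    ... | false | ea′ = ⊥-elim (true≢false (trans (sym ea) (sym ea′)))

  image-⇒ : ∀ v → lookup (image f e) v ≡ true → Σ (Fin m) λ a → lookup e a ≡ true × f a ≡ v
  image-⇒ v h with ⋃-⇒ piece (allFin _) v h
  ... | a , p = a , piece-⇒ a v p

  image-⇐ : ∀ a → lookup e a ≡ true → lookup (image f e) (f a) ≡ true
  image-⇐ a ea = ⋃-⇐ piece (allFin _) (f a) a (∈-allFin a) (piece-⇐ a ea)

foldr∨-false : ∀ {A : Set} (p : A → Bool) xs → (∀ x → p x ≡ false) → foldr _∨_ false (map p xs) ≡ false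
foldr∨-false p []       h = refl
foldr∨-false p (x ∷ xs) h rewrite h x = foldr∨-false p xs h

foldr∨-false⁻ : ∀ {A : Set} (p : A → Bool) xs x → Any (x ≡_) xs → foldr _∨_ false (map p xs) ≡ false → p x ≡ false
foldr∨-false⁻ p (y ∷ xs) x (here refl) h with p x
... | false = refl
foldr∨-false⁻ p (y ∷ xs) x (there k) h with p y
... | false = foldr∨-false⁻ p xs x k h

size-∪-⁅⁆ : ∀ {n} (g : Subset n) v → lookup g v ≡ false → S.∣ g ∪ ⁅ v ⁆ ∣ ≡ S.∣ g ∣ + 1
size-∪-⁅⁆ {n} g v v∉g = begin
    S.∣ g ∪ ⁅ v ⁆ ∣
  ≡⟨ size≡sum (g ∪ ⁅ v ⁆) ⟩
    sumL (λ w → ⟦ lookup (g ∪ ⁅ v ⁆) w ⟧) (allFin n)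
  ≡⟨ sumL-cong (λ w → trans (cong ⟦_⟧ (lookup-∪ g ⁅ v ⁆ w)) (⟦∨⟧ _ _ (disjoint w))) (allFin n) ⟩
    sumL (λ w → ⟦ lookup g w ⟧ + ⟦ lookup ⁅ v ⁆ w ⟧) (allFin n)
  ≡⟨ sumL-+ _ _ (allFin n) ⟩
    sumL (λ w → ⟦ lookup g w ⟧) (allFin n) + sumL (λ w → ⟦ lookup ⁅ v ⁆ w ⟧) (allFin n)
  ≡⟨ cong₂ _+_ (sym (size≡sum g)) (trans (sumL-cong (λ w → cong ⟦_⟧ (lookup-⁅⁆ v w)) (allFin n)) (allFin-once n v)) ⟩
    S.∣ g ∣ + 1 ∎
  where
  open ≡-Reasoning
  disjoint : ∀ w → lookup g w ≡ true → lookup ⁅ v ⁆ w ≡ false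
  disjoint w w∈g = trans (lookup-⁅⁆ v w) (dec-false (w F.≟ v) λ { refl → true≢false (trans (sym w∈g) v∉g) })

insertAt-update : ∀ {A : Set} {n} (y : Vec A n) i v u → insertAt y i v [ i ]≔ u ≡ insertAt y i u
insertAt-update y       zero    v u = refl
insertAt-update (a ∷ y) (suc i) v u = cong (a ∷_) (insertAt-update y i v u)

insertAt-other : ∀ {A : Set} {n} (y : Vec A n) i u v c → c ≢ i →
  lookup (insertAt y i u) c ≡ lookup (insertAt y i v) c
insertAt-other y i u v c c≢i =
  trans (cong (λ z → lookup z c) (sym (insertAt-update y i v u))) (VP.lookup∘update′ c≢i (insertAt y i v) u)

except : ∀ {n} → Fin n → List (Fin n) → List (Fin n)
except j = filter (λ i → B._≟_ (not (does (i F.≟ j))) true)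

sum-except : ∀ {n} (j : Fin n) (f : Fin n → ℕ) xs →
  sumL f (except j xs) ≡ sumL (λ i → ⟦ not (does (i F.≟ j)) ⟧ * f i) xs
sum-except j f []       = refl
sum-except j f (i ∷ xs) with i F.≟ j
... | yes _ = sum-except j f xs
... | no  _ = cong₂ _+_ (sym (*-identityˡ (f i))) (sum-except j f xs)

sum-split : ∀ n (j : Fin n) (f : Fin n → ℕ) → sumL f (allFin n) ≡ f j + sumL f (except j (allFin n))
sum-split n j f = begin
    sumL f (allFin n)
  ≡⟨ sumL-cong split-term (allFin n) ⟩
    sumL (λ i → ⟦ does (i F.≟ j) ⟧ * f i + ⟦ not (does (i F.≟ j)) ⟧ * f i) (allFin n)
  ≡⟨ sumL-+ _ _ (allFin n) ⟩
    sumL (λ i → ⟦ does (i F.≟ j) ⟧ * f i) (allFin n) + sumL (λ i → ⟦ not (does (i F.≟ j)) ⟧ * f i) (allFin n)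
  ≡⟨ cong₂ _+_ (sum-pickFin n f j) (sym (sum-except j f (allFin n))) ⟩
    f j + sumL f (except j (allFin n)) ∎
  where
  open ≡-Reasoning
  split-term : ∀ i → f i ≡ ⟦ does (i F.≟ j) ⟧ * f i + ⟦ not (does (i F.≟ j)) ⟧ * f i
  split-term i with does (i F.≟ j)
  ... | true  = sym (trans (+-identityʳ _) (+-identityʳ (f i)))
  ... | false = sym (+-identityʳ (f i))

prodL-map : ∀ {A B : Set} (f : B → ℕ) (g : A → B) xs → prodL (map f (map g xs)) ≡ prodL (map (λ x → f (g x)) xs)
prodL-map f g []       = refl
prodL-map f g (x ∷ xs) = cong (f (g x) *_) (prodL-map f g xs)

prodFin-suc : ∀ n (f : Fin (suc n) → ℕ) → prodL (map f (allFin (suc n))) ≡ f zero * prodL (map (λ i → f (suc i)) (allFin n))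
prodFin-suc n f = trans (cong (λ l → prodL (map f l)) (allFin-suc n)) (cong (f zero *_) (prodL-map f suc (allFin n)))

prod-split : ∀ n (j : Fin n) (f : Fin n → ℕ) → prodL (map f (allFin n)) ≡ f j * prodL (map f (except j (allFin n)))
prod-split n j f = trans (factor (allFin n)) (cong (_* prodL (map f (except j (allFin n)))) (only-j n f j))
  where
  at : ∀ {n} → Fin n → (Fin n → ℕ) → Fin n → ℕ
  at j f i = if does (i F.≟ j) then f i else 1
  factor : ∀ xs → prodL (map f xs) ≡ prodL (map (at j f) xs) * prodL (map f (except j xs))
  factor []       = refl
  factor (i ∷ xs) with i F.≟ j
  ... | yes _ = trans (cong (f i *_) (factor xs)) (sym (*-assoc (f i) _ _))
  ... | no  _ = trans (cong (f i *_) (factor xs)) (rearrange (f i) (prodL (map (at j f) xs)) (prodL (map f (except j xs))))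
    where
    rearrange : ∀ a b c → a * (b * c) ≡ (1 * b) * (a * c)
    rearrange = solve-∀
  ones : ∀ {A : Set} (xs : List A) → prodL (map (λ _ → 1) xs) ≡ 1
  ones []       = refl
  ones (x ∷ xs) = trans (+-identityʳ _) (ones xs)
  only-j : ∀ n (f : Fin n → ℕ) j → prodL (map (at j f) (allFin n)) ≡ f j
  only-j (suc n) f zero    = trans (prodFin-suc n (at zero f)) (trans (cong (f zero *_) (ones (allFin n))) (*-identityʳ _))
  only-j (suc n) f (suc j) = begin
      prodL (map (at (suc j) f) (allFin (suc n)))
    ≡⟨ prodFin-suc n (at (suc j) f) ⟩
      1 * prodL (map (λ i → at (suc j) f (suc i)) (allFin n))
    ≡⟨ *-identityˡ _ ⟩
      prodL (map (λ i → at (suc j) f (suc i)) (allFin n))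
    ≡⟨ cong prodL (LP.map-cong (λ i → cong (if_then f (suc i) else 1) (does-⇔ (suc i F.≟ suc j) (i F.≟ j) suc-injective (cong suc))) (allFin n)) ⟩
      prodL (map (at j (λ i → f (suc i))) (allFin n))
    ≡⟨ only-j n (λ i → f (suc i)) j ⟩
      f (suc j) ∎
    where open ≡-Reasoning

prodL-nonZero : ∀ {A : Set} (f : A → ℕ) → (∀ a → NonZero (f a)) → ∀ xs → NonZero (prodL (map f xs))
prodL-nonZero f nz []       = _
prodL-nonZero f nz (c ∷ xs) = m*n≢0 (f c) _ {{nz c}} {{prodL-nonZero f nz xs}}

-- Rearranging Fin n so that the positions failing a test come first: if at
-- most k positions fail `good`, some injection σ makes every position m ≥ k
-- land on a good one.
record Arrangement (n : ℕ) (good : Fin n → Bool) (k : ℕ) : Set where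
  field
    σ         : Fin n → Fin n
    injective : Injective _≡_ _≡_ σ
    late-good : ∀ m → k ≤ F.toℕ m → good (σ m) ≡ true

prepend-bad : ∀ {n good k} → Arrangement n (λ i → good (suc i)) k → Arrangement (suc n) good (suc k)
prepend-bad {n} {good} {k} A = record { σ = σ ; injective = injective ; late-good = late-good }
  where
  module A = Arrangement A
  σ : Fin (suc n) → Fin (suc n)
  σ zero    = zero
  σ (suc m) = suc (A.σ m)
  injective : Injective _≡_ _≡_ σ
  injective {zero}  {zero}  _ = refl
  injective {suc a} {suc b} e = cong suc (A.injective (suc-injective e))
  late-good : ∀ m → suc k ≤ F.toℕ m → good (σ m) ≡ true
  late-good (suc m) (s≤s k≤m) = A.late-good m k≤m

-- A good first position is placed last, the rest arranged before it.
append-good : ∀ {n good k} → good zero ≡ true → Arrangement n (λ i → good (suc i)) k → Arrangement (suc n) good k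
append-good {n} {good} {k} good0 A = record { σ = σ ; injective = λ {a} {b} → injective a b _ _ ; late-good = λ m → late-good m _ }
  where
  module A = Arrangement A
  place : (m : Fin (suc n)) → Dec (n ≡ F.toℕ m) → Fin (suc n)
  place m (yes _)    = zero
  place m (no n≢m)   = suc (A.σ (F.lower₁ m n≢m))
  σ : Fin (suc n) → Fin (suc n)
  σ m = place m (n N.≟ F.toℕ m)
  injective : ∀ a b (a? : Dec (n ≡ F.toℕ a)) (b? : Dec (n ≡ F.toℕ b)) → place a a? ≡ place b b? → a ≡ b
  injective a b (yes n≡a) (yes n≡b) _ = FP.toℕ-injective (trans (sym n≡a) n≡b)
  injective a b (no _)    (no _)    e = FP.lower₁-injective (A.injective (suc-injective e))
  late-good : ∀ m (m? : Dec (n ≡ F.toℕ m)) → k ≤ F.toℕ m → good (place m m?) ≡ true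
  late-good m (yes _)  _   = good0
  late-good m (no n≢m) k≤m = A.late-good (F.lower₁ m n≢m) (subst (k ≤_) (sym (FP.toℕ-lower₁ m n≢m)) k≤m)

arrange : ∀ n (good : Fin n → Bool) k → sumL (λ c → ⟦ not (good c) ⟧) (allFin n) ≤ k → Arrangement n good k
arrange zero    good k _     = record { σ = λ () ; injective = λ {} ; late-good = λ () }
arrange (suc n) good k bad≤k = by-first (good zero) refl
  where
  rest = sumL (λ c → ⟦ not (good (suc c)) ⟧) (allFin n)
  split : ∀ b → good zero ≡ b → ⟦ not b ⟧ + rest ≤ k
  split b refl = subst (_≤ k) (sumFin-suc n (λ c → ⟦ not (good c) ⟧)) bad≤k
  after-bad : ∀ {k} → suc rest ≤ k → Arrangement (suc n) good k
  after-bad (s≤s rest≤k) = prepend-bad (arrange n (λ i → good (suc i)) _ rest≤k)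
  by-first : ∀ b → good zero ≡ b → Arrangement (suc n) good k
  by-first true  good0 = append-good good0 (arrange n (λ i → good (suc i)) k (split true good0))
  by-first false bad0  = after-bad (split false bad0)

injective⇒surjective : ∀ {n} (σ : Fin n → Fin n) → Injective _≡_ _≡_ σ → ∀ c → Σ (Fin n) λ a → σ a ≡ c
injective⇒surjective {suc n} σ inj c with FP.any? (λ a → σ a F.≟ c)
... | yes hit = hit
... | no miss = ⊥-elim (collision (FP.pigeonhole (n<1+n n) τ))
  where
  τ : Fin (suc n) → Fin n
  τ a = F.punchOut {i = c} {j = σ a} (λ e → miss (a , sym e))
  collision : (∃ λ i → ∃ λ j → i F.< j × τ i ≡ τ j) → ⊥
  collision (i , j , i<j , τi≡τj) = <-irrefl (cong F.toℕ (inj (FP.punchOut-injective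
    {i = c} {j = σ i} {k = σ j} (λ e → miss (i , sym e)) (λ e → miss (j , sym e)) τi≡τj))) i<j

-- Transversals of G: tuples x = (x_c)_c with x_c ∈ V_c.  Sums over
-- transversals are sums over all tuples weighted by the transversal indicator.
module Transversals {r : ℕ} (G : PartiteGraph r) where
  open PartiteGraph G
  open VecEnumeration (allFin N)

  Tuple : Set
  Tuple = Vec (Fin N) (suc r)

  tuples : List Tuple
  tuples = allVecs (suc r)

  IsTransversal : Tuple → Set
  IsTransversal x = ∀ c → cls (lookup x c) ≡ c

  transversal? : (x : Tuple) → Dec (IsTransversal x)
  transversal? x = FP.all? (λ c → cls (lookup x c) F.≟ c)

  T : Tuple → ℕ
  T x = ⟦ does (transversal? x) ⟧

  size : Fin (suc r) → ℕ
  size c = classSize G c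

  inV : Fin N → Fin (suc r) → ℕ
  inV u c = ⟦ does (cls u F.≟ c) ⟧

  classSize≡sum : ∀ c → size c ≡ sumL (λ u → inV u c) (allFin N)
  classSize≡sum c = countL≡sumL (λ u → inClass G u c) (allFin N)

  volume : ℕ
  volume = prodL (map size (allFin (suc r)))

  volume-nonZero : (∀ c → NonZero (size c)) → NonZero volume
  volume-nonZero nonempty = prodL-nonZero size nonempty (allFin (suc r))

  -- Σ_{i≠j} |E(P_i)| |V_i|, the numerator of Σ_{i≠j} ρ(i) over the denominator volume.
  weight : Fin (suc r) → ℕ
  weight j = sumL (λ i → edgesP G i * size i) (except j (allFin (suc r)))

  count-typed : ∀ m (t : Fin m → Fin (suc r)) →
    sumL (λ x → ⟦ does (FP.all? (λ c → cls (lookup x c) F.≟ t c)) ⟧) (allVecs m) ≡ prodL (map (λ c → size (t c)) (allFin m))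
  count-typed zero    t = refl
  count-typed (suc m) t = begin
      sumL (λ x → ⟦ does (typed? t x) ⟧) (allVecs (suc m))
    ≡⟨ sumVec-suc m (λ x → ⟦ does (typed? t x) ⟧) ⟩
      sumL (λ u → sumL (λ y → ⟦ does (typed? t (u ∷ y)) ⟧) (allVecs m)) (allFin N)
    ≡⟨ sumL-cong (λ u → sumL-cong (head-tail u) (allVecs m)) (allFin N) ⟩
      sumL (λ u → sumL (λ y → inV u (t zero) * ⟦ does (typed? (λ c → t (suc c)) y) ⟧) (allVecs m)) (allFin N)
    ≡⟨ sumL-cong (λ u → sumL-*ˡ (inV u (t zero)) _ (allVecs m)) (allFin N) ⟩
      sumL (λ u → inV u (t zero) * sumL (λ y → ⟦ does (typed? (λ c → t (suc c)) y) ⟧) (allVecs m)) (allFin N)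
    ≡⟨ sumL-*ʳ _ (λ u → inV u (t zero)) (allFin N) ⟩
      sumL (λ u → inV u (t zero)) (allFin N) * sumL (λ y → ⟦ does (typed? (λ c → t (suc c)) y) ⟧) (allVecs m)
    ≡⟨ cong₂ _*_ (sym (classSize≡sum (t zero))) (count-typed m (λ c → t (suc c))) ⟩
      size (t zero) * prodL (map (λ c → size (t (suc c))) (allFin m))
    ≡⟨ sym (prodFin-suc m (λ c → size (t c))) ⟩
      prodL (map (λ c → size (t c)) (allFin (suc m))) ∎
    where
    open ≡-Reasoning
    typed? : ∀ {m} (t : Fin m → Fin (suc r)) (x : Vec (Fin N) m) → Dec (∀ c → cls (lookup x c) ≡ t c)
    typed? t x = FP.all? (λ c → cls (lookup x c) F.≟ t c)
    head-tail : ∀ u y → ⟦ does (typed? t (u ∷ y)) ⟧ ≡ inV u (t zero) * ⟦ does (typed? (λ c → t (suc c)) y) ⟧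
    head-tail u y = ⟦⟧-× (typed? t (u ∷ y)) (cls u F.≟ t zero) (typed? (λ c → t (suc c)) y)
      (λ typed → typed zero , λ c → typed (suc c)) (λ { p q zero → p ; p q (suc c) → q c })

  transversal-count : sumL T tuples ≡ volume
  transversal-count = count-typed (suc r) (λ c → c)

  transversal-exchange : ∀ (y : Vec (Fin N) r) i u v → T (insertAt y i v) * inV u i ≡ inV v i * T (insertAt y i u)
  transversal-exchange y i u v =
    trans (sym (⟦⟧-× both (transversal? (insertAt y i v)) (cls u F.≟ i) (λ p → p) _,_))
          (⟦⟧-× both (cls v F.≟ i) (transversal? (insertAt y i u)) (exchanged u v) (λ cv t → swap (exchanged v u (t , cv))))
    where
    both = transversal? (insertAt y i v) ×-dec (cls u F.≟ i)
    exchanged : ∀ u v → IsTransversal (insertAt y i v) × cls u ≡ i → cls v ≡ i × IsTransversal (insertAt y i u)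
    exchanged u v (t , cu) = subst (λ z → cls z ≡ i) (VP.insertAt-lookup y i v) (t i) , transversal
      where
      transversal : IsTransversal (insertAt y i u)
      transversal c with c F.≟ i
      ... | yes refl = trans (cong cls (VP.insertAt-lookup y i u)) cu
      ... | no  c≢i  = trans (cong cls (insertAt-other y i u v c c≢i)) (t c)

  resampled : Fin (suc r) → (Tuple → ℕ) → Tuple → ℕ
  resampled i F x = sumL (λ u → inV u i * F (x [ i ]≔ u)) (allFin N)

  -- For fixed y, summing over the vertex v inserted at position i and over
  -- its replacement u ∈ V_i: the pair (v, u) may be exchanged.
  resample-fibre : ∀ i (F : Tuple → ℕ) (y : Vec (Fin N) r) →
    sumL (λ v → T (insertAt y i v) * resampled i F (insertAt y i v)) (allFin N)
      ≡ size i * sumL (λ u → T (insertAt y i u) * F (insertAt y i u)) (allFin N)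
  resample-fibre i F y = begin
      sumL (λ v → T (ins v) * resampled i F (ins v)) (allFin N)
    ≡⟨ sumL-cong (λ v → sym (sumL-*ˡ (T (ins v)) (λ u → inV u i * F (ins v [ i ]≔ u)) (allFin N))) (allFin N) ⟩
      sumL (λ v → sumL (λ u → T (ins v) * (inV u i * F (ins v [ i ]≔ u))) (allFin N)) (allFin N)
    ≡⟨ sumL-cong (λ v → sumL-cong (λ u → exchange u v) (allFin N)) (allFin N) ⟩
      sumL (λ v → sumL (λ u → inV v i * (T (ins u) * F (ins u))) (allFin N)) (allFin N)
    ≡⟨ sumL-cong (λ v → sumL-*ˡ (inV v i) (λ u → T (ins u) * F (ins u)) (allFin N)) (allFin N) ⟩
      sumL (λ v → inV v i * sumL (λ u → T (ins u) * F (ins u)) (allFin N)) (allFin N)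
    ≡⟨ sumL-*ʳ _ (λ v → inV v i) (allFin N) ⟩
      sumL (λ v → inV v i) (allFin N) * sumL (λ u → T (ins u) * F (ins u)) (allFin N)
    ≡⟨ cong (_* sumL (λ u → T (ins u) * F (ins u)) (allFin N)) (sym (classSize≡sum i)) ⟩
      size i * sumL (λ u → T (ins u) * F (ins u)) (allFin N) ∎
    where
    open ≡-Reasoning
    ins : Fin N → Tuple
    ins v = insertAt y i v
    exchange : ∀ u v → T (ins v) * (inV u i * F (ins v [ i ]≔ u)) ≡ inV v i * (T (ins u) * F (ins u))
    exchange u v = begin
        T (ins v) * (inV u i * F (ins v [ i ]≔ u))
      ≡⟨ cong (λ z → T (ins v) * (inV u i * F z)) (insertAt-update y i v u) ⟩
        T (ins v) * (inV u i * F (ins u))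
      ≡⟨ sym (*-assoc (T (ins v)) (inV u i) _) ⟩
        (T (ins v) * inV u i) * F (ins u)
      ≡⟨ cong (_* F (ins u)) (transversal-exchange y i u v) ⟩
        (inV v i * T (ins u)) * F (ins u)
      ≡⟨ *-assoc (inV v i) _ _ ⟩
        inV v i * (T (ins u) * F (ins u)) ∎

  resample : ∀ i (F H : Tuple → ℕ) → (∀ x → IsTransversal x → H x ≡ resampled i F x) →
    sumL (λ x → T x * H x) tuples ≡ size i * sumL (λ x → T x * F x) tuples
  resample i F H H≡ = begin
      sumL (λ x → T x * H x) tuples
    ≡⟨ sumL-cong (λ x → ⟦⟧-*-cong (transversal? x) (H≡ x)) tuples ⟩
      sumL (λ x → T x * resampled i F x) tuples
    ≡⟨ sumVec-insertAt r i (λ x → T x * resampled i F x) ⟩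
      sumL (λ v → sumL (λ y → T (insertAt y i v) * resampled i F (insertAt y i v)) (allVecs r)) (allFin N)
    ≡⟨ sumL-swap (λ v y → T (insertAt y i v) * resampled i F (insertAt y i v)) (allFin N) (allVecs r) ⟩
      sumL (λ y → sumL (λ v → T (insertAt y i v) * resampled i F (insertAt y i v)) (allFin N)) (allVecs r)
    ≡⟨ sumL-cong (resample-fibre i F) (allVecs r) ⟩
      sumL (λ y → size i * sumL (λ u → T (insertAt y i u) * F (insertAt y i u)) (allFin N)) (allVecs r)
    ≡⟨ sumL-*ˡ (size i) _ (allVecs r) ⟩
      size i * sumL (λ y → sumL (λ u → T (insertAt y i u) * F (insertAt y i u)) (allFin N)) (allVecs r)
    ≡⟨ cong (size i *_) (sumL-swap (λ y u → T (insertAt y i u) * F (insertAt y i u)) (allVecs r) (allFin N)) ⟩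
      size i * sumL (λ u → sumL (λ y → T (insertAt y i u) * F (insertAt y i u)) (allVecs r)) (allFin N)
    ≡⟨ cong (size i *_) (sym (sumVec-insertAt r i (λ x → T x * F x))) ⟩
      size i * sumL (λ x → T x * F x) tuples ∎
    where open ≡-Reasoning

module Faces {r : ℕ} (G : PartiteGraph r) where
  open PartiteGraph G
  open VecEnumeration (allFin N)
  open Transversals G

  Misses : Subset N → Fin (suc r) → Set
  Misses s c = ∀ v → lookup s v ≡ true → cls v ≢ c

  avoids?-sound : ∀ s c → avoids? G s c ≡ true → Misses s c
  avoids?-sound s c h v sv cv = true≢false (trans (sym (cong₂ _∧_ (trans (mem≡lookup v s) sv) (dec-true⁻ (cls v F.≟ c) cv))) v-absent)
    where
    v-absent : mem v s ∧ inClass G v c ≡ false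
    v-absent = foldr∨-false⁻ (λ x → mem x s ∧ inClass G x c) (allFin N) v (∈-allFin v) (not-true _ h)

  avoids?-complete : ∀ s c → Misses s c → avoids? G s c ≡ true
  avoids?-complete s c misses = cong not (foldr∨-false _ (allFin N) absent)
    where
    absent : ∀ v → mem v s ∧ inClass G v c ≡ false
    absent v with lookup s v in sv | mem≡lookup v s
    ... | false | mv = cong (_∧ inClass G v c) mv
    ... | true  | mv = trans (cong (_∧ inClass G v c) mv) (dec-false (cls v F.≟ c) (misses v sv))

  edge-partite : ∀ s → edge s ≡ true → ∀ v w → lookup s v ≡ true → lookup s w ≡ true → cls v ≡ cls w → v ≡ w
  edge-partite s es v w sv sw = partite s es v w (lookup⇒∈ sv) (lookup⇒∈ sw)

  classCount : Subset N → Fin (suc r) → ℕ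
  classCount s l = sumL (λ v → ⟦ lookup s v ∧ does (cls v F.≟ l) ⟧) (allFin N)

  size-by-class : ∀ s → S.∣ s ∣ ≡ sumL (classCount s) (allFin (suc r))
  size-by-class s = begin
      S.∣ s ∣
    ≡⟨ size≡sum s ⟩
      sumL (λ v → ⟦ lookup s v ⟧) (allFin N)
    ≡⟨ sumL-cong (λ v → sym (spread v)) (allFin N) ⟩
      sumL (λ v → sumL (λ l → ⟦ lookup s v ∧ does (cls v F.≟ l) ⟧) (allFin (suc r))) (allFin N)
    ≡⟨ sumL-swap _ (allFin N) (allFin (suc r)) ⟩
      sumL (classCount s) (allFin (suc r)) ∎
    where
    open ≡-Reasoning
    -- every vertex lies in exactly one class
    spread : ∀ v → sumL (λ l → ⟦ lookup s v ∧ does (cls v F.≟ l) ⟧) (allFin (suc r)) ≡ ⟦ lookup s v ⟧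
    spread v = begin
        sumL (λ l → ⟦ lookup s v ∧ does (cls v F.≟ l) ⟧) (allFin (suc r))
      ≡⟨ sumL-cong (λ l → trans (⟦∧⟧ (lookup s v) _) (*-comm ⟦ lookup s v ⟧ _)) (allFin (suc r)) ⟩
        sumL (λ l → ⟦ does (cls v F.≟ l) ⟧ * ⟦ lookup s v ⟧) (allFin (suc r))
      ≡⟨ sumL-cong (λ l → cong (λ b → ⟦ b ⟧ * ⟦ lookup s v ⟧) (does-⇔ (cls v F.≟ l) (l F.≟ cls v) sym sym)) (allFin (suc r)) ⟩
        sumL (λ l → ⟦ does (l F.≟ cls v) ⟧ * ⟦ lookup s v ⟧) (allFin (suc r))
      ≡⟨ sum-pickFin (suc r) (λ _ → ⟦ lookup s v ⟧) (cls v) ⟩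
        ⟦ lookup s v ⟧ ∎

  edge-classCount≤1 : ∀ s → edge s ≡ true → ∀ l → classCount s l ≤ 1
  edge-classCount≤1 s es l = count-atMostOne N _ (λ v w a b →
    let (sv , cv) = ∧-true _ _ a ; (sw , cw) = ∧-true _ _ b in
    edge-partite s es v w sv sw (trans (dec-true (cls v F.≟ l) cv) (sym (dec-true (cls w F.≟ l) cw))))

  classCount-missed : ∀ s c → Misses s c → classCount s c ≡ 0
  classCount-missed s c misses = trans (sumL-cong none (allFin N)) (sumL-zero (allFin N))
    where
    none : ∀ v → ⟦ lookup s v ∧ does (cls v F.≟ c) ⟧ ≡ 0
    none v with lookup s v in sv
    ... | false = refl
    ... | true  = cong ⟦_⟧ (dec-false (cls v F.≟ c) (misses v sv))

  -- An edge (r vertices, at most one per class) missing V_c cannot also miss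
  -- another class V_l: it would have at most r - 1 vertices.
  edge-misses-one : ∀ s c l → edge s ≡ true → Misses s c → l ≢ c → classCount s l ≢ 0
  edge-misses-one s c l es misses l≢c count≡0 = 1+n≰n (subst (_≤ suc r) two-more covered)
    where
    open ≤-Reasoning
    total = sumL (classCount s) (allFin (suc r))
    is : Fin (suc r) → Fin (suc r) → ℕ
    is a l′ = ⟦ does (l′ F.≟ a) ⟧
    two-more : total + 1 + 1 ≡ suc (suc r)
    two-more = begin-equality
      total + 1 + 1  ≡⟨ cong (λ t → t + 1 + 1) (trans (sym (size-by-class s)) (uniform s es)) ⟩
      r + 1 + 1      ≡⟨ r+2 r ⟩
      suc (suc r)    ∎
      where
      r+2 : ∀ r → r + 1 + 1 ≡ suc (suc r)
      r+2 = solve-∀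
    -- each class is hit by s, or is c, or is l — at most one of these
    at-most-one : ∀ l′ → classCount s l′ + is c l′ + is l l′ ≤ 1
    at-most-one l′ with l′ F.≟ c | l′ F.≟ l
    ... | yes refl | yes refl = ⊥-elim (l≢c refl)
    ... | yes refl | no _     = subst (λ t → t + 1 + 0 ≤ 1) (sym (classCount-missed s l′ misses)) ≤-refl
    ... | no _     | yes refl = subst (λ t → t + 0 + 1 ≤ 1) (sym count≡0) ≤-refl
    ... | no _     | no _     = subst (_≤ 1) (sym (trans (+-identityʳ _) (+-identityʳ _))) (edge-classCount≤1 s es l′)

    covered : total + 1 + 1 ≤ suc r
    covered = begin
        total + 1 + 1
      ≡⟨ cong₂ (λ a b → total + a + b) (sym (allFin-once (suc r) c)) (sym (allFin-once (suc r) l)) ⟩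
        total + sumL (is c) (allFin (suc r)) + sumL (is l) (allFin (suc r))
      ≡⟨ trans (cong (_+ sumL (is l) (allFin (suc r))) (sym (sumL-+ (classCount s) (is c) (allFin (suc r)))))
                (sym (sumL-+ (λ l′ → classCount s l′ + is c l′) (is l) (allFin (suc r)))) ⟩
        sumL (λ l′ → classCount s l′ + is c l′ + is l l′) (allFin (suc r))
      ≤⟨ sumL-mono at-most-one (allFin (suc r)) ⟩
        sumL (λ _ → 1) (allFin (suc r))
      ≡⟨ sumFin-const (suc r) ⟩
        suc r ∎

  edge-meets : ∀ s c → edge s ≡ true → Misses s c → ∀ l → l ≢ c → Σ (Fin N) λ w → lookup s w ≡ true × cls w ≡ l
  edge-meets s c es misses l l≢c with positive-term _ (allFin N) (n≢0⇒n>0 (edge-misses-one s c l es misses l≢c))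
  ... | w , pos = w , member w pos
    where
    member : ∀ w → 0 N.< ⟦ lookup s w ∧ does (cls w F.≟ l) ⟧ → lookup s w ≡ true × cls w ≡ l
    member w pos with lookup s w | cls w F.≟ l
    ... | true | yes cw = refl , cw

  face : Tuple → Fin (suc r) → Subset N
  face x c = image (lookup x) (∁ ⁅ c ⁆)

  E : Fin (suc r) → Tuple → ℕ
  E c x = ⟦ edge (face x c) ⟧

  face-⇒ : ∀ x c v → lookup (face x c) v ≡ true → Σ (Fin (suc r)) λ a → a ≢ c × lookup x a ≡ v
  face-⇒ x c v h = let (a , p , q) = image-⇒ (lookup x) (∁ ⁅ c ⁆) v h in a , ∁⁅⁆-true⁻ c a p , q

  face-⇐ : ∀ x c a → a ≢ c → lookup (face x c) (lookup x a) ≡ true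
  face-⇐ x c a a≢c = image-⇐ (lookup x) (∁ ⁅ c ⁆) a (∁⁅⁆-true c a a≢c)

  face-misses : ∀ x c → IsTransversal x → Misses (face x c) c
  face-misses x c t v h cv = let (a , a≢c , e) = face-⇒ x c v h in a≢c (trans (sym (t a)) (trans (cong cls e) cv))

-- Counting transversals through faces: every edge of P_c is the face opposite
-- c of exactly |V_c| transversals, so Σ_x E_c(x) = |V_c| |E(P_c)|.
module FaceCounting {r : ℕ} (G : PartiteGraph r) where
  open PartiteGraph G
  open VecEnumeration (allFin N)
  open Transversals G
  open Faces G

  _≟T_ : DecidableEquality Tuple
  _≟T_ = VP.≡-dec F._≟_

  class-witness : ∀ c → NonZero (size c) → Σ (Fin N) λ u → cls u ≡ c
  class-witness c nonempty with positive-term (λ u → inV u c) (allFin N) (subst (0 N.<_) (classSize≡sum c) (N.>-nonZero⁻¹ (size c) {{nonempty}}))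
  ... | u , pos = u , in-class u pos
    where
    in-class : ∀ u → 0 N.< inV u c → cls u ≡ c
    in-class u pos with cls u F.≟ c
    ... | yes cu = cu

  -- Completing s by u₀
  -- gives a transversal x₀, and the transversals with face s opposite c are
  -- exactly x₀ with its c-th vertex replaced by any u ∈ V_c.
  module Completion (s : Subset N) (c : Fin (suc r)) (es : edge s ≡ true) (misses : Misses s c)
                    (u₀ : Fin N) (u₀∈V : cls u₀ ≡ c) where

    pick : ∀ l → Dec (l ≡ c) → Fin N
    pick l (yes _)   = u₀
    pick l (no l≢c)  = proj₁ (edge-meets s c es misses l l≢c)

    pick-cls : ∀ l l? → cls (pick l l?) ≡ l
    pick-cls l (yes l≡c) = trans u₀∈V (sym l≡c)
    pick-cls l (no l≢c)  = proj₂ (proj₂ (edge-meets s c es misses l l≢c))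

    pick-in : ∀ l l? → l ≢ c → lookup s (pick l l?) ≡ true
    pick-in l (yes l≡c) l≢c = ⊥-elim (l≢c l≡c)
    pick-in l (no l≢c′) _   = proj₁ (proj₂ (edge-meets s c es misses l l≢c′))

    x₀ : Tuple
    x₀ = V.tabulate (λ l → pick l (l F.≟ c))

    x₀-cls : ∀ l → cls (lookup x₀ l) ≡ l
    x₀-cls l = trans (cong cls (VP.lookup∘tabulate (λ l → pick l (l F.≟ c)) l)) (pick-cls l (l F.≟ c))

    x₀-in : ∀ l → l ≢ c → lookup s (lookup x₀ l) ≡ true
    x₀-in l l≢c = trans (cong (lookup s) (VP.lookup∘tabulate (λ l → pick l (l F.≟ c)) l)) (pick-in l (l F.≟ c) l≢c)

    fibre-⇒ : ∀ x → IsTransversal x × s ≡ face x c → cls (lookup x c) ≡ c × x ≡ x₀ [ c ]≔ lookup x c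
    fibre-⇒ x (t , s≡face) = t c , vec-ext x (x₀ [ c ]≔ lookup x c) agree
      where
      agree : ∀ l → lookup x l ≡ lookup (x₀ [ c ]≔ lookup x c) l
      agree l with l F.≟ c
      ... | yes refl = sym (VP.lookup∘update l x₀ (lookup x l))
      ... | no l≢c   = trans (edge-partite s es (lookup x l) (lookup x₀ l)
                                (trans (cong (λ z → lookup z (lookup x l)) s≡face) (face-⇐ x c l l≢c))
                                (x₀-in l l≢c) (trans (t l) (sym (x₀-cls l))))
                             (sym (VP.lookup∘update′ l≢c x₀ (lookup x c)))

    fibre-⇐ : ∀ x → cls (lookup x c) ≡ c → x ≡ x₀ [ c ]≔ lookup x c → IsTransversal x × s ≡ face x c
    fibre-⇐ x xc∈V x≡ = transversal , subset-ext s (face x c) s⊆face face⊆s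
      where
      off-c : ∀ l → l ≢ c → lookup x l ≡ lookup x₀ l
      off-c l l≢c = trans (cong (λ z → lookup z l) x≡) (VP.lookup∘update′ l≢c x₀ (lookup x c))
      transversal : IsTransversal x
      transversal l with l F.≟ c
      ... | yes refl = xc∈V
      ... | no l≢c   = trans (cong cls (off-c l l≢c)) (x₀-cls l)
      s⊆face : ∀ v → lookup s v ≡ true → lookup (face x c) v ≡ true
      s⊆face v sv = subst (λ w → lookup (face x c) w ≡ true) (trans (off-c (cls v) v∉V) x₀v≡v) (face-⇐ x c (cls v) v∉V)
        where
        v∉V : cls v ≢ c
        v∉V = misses v sv
        x₀v≡v : lookup x₀ (cls v) ≡ v
        x₀v≡v = edge-partite s es _ v (x₀-in (cls v) v∉V) sv (x₀-cls (cls v))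
      face⊆s : ∀ v → lookup (face x c) v ≡ true → lookup s v ≡ true
      face⊆s v h = let (a , a≢c , e) = face-⇒ x c v h in
        subst (λ w → lookup s w ≡ true) (trans (sym (off-c a a≢c)) e) (x₀-in a a≢c)

    fibre-indicator : ∀ x → T x * ⟦ does (s ≟S face x c) ⟧ ≡ sumL (λ u → inV u c * ⟦ does (x ≟T (x₀ [ c ]≔ u)) ⟧) (allFin N)
    fibre-indicator x = begin
        T x * ⟦ does (s ≟S face x c) ⟧
      ≡⟨ sym (⟦⟧-× both (transversal? x) (s ≟S face x c) (λ p → p) _,_) ⟩
        ⟦ does both ⟧
      ≡⟨ ⟦⟧-× both (cls (lookup x c) F.≟ c) (x ≟T (x₀ [ c ]≔ lookup x c)) (fibre-⇒ x) (fibre-⇐ x) ⟩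
        inV (lookup x c) c * ⟦ does (x ≟T (x₀ [ c ]≔ lookup x c)) ⟧
      ≡⟨ sym (sum-pickFin N (λ u → inV u c * ⟦ does (x ≟T (x₀ [ c ]≔ lookup x c)) ⟧) (lookup x c)) ⟩
        sumL (λ u → ⟦ does (u F.≟ lookup x c) ⟧ * (inV u c * ⟦ does (x ≟T (x₀ [ c ]≔ lookup x c)) ⟧)) (allFin N)
      ≡⟨ sumL-cong only-xc (allFin N) ⟩
        sumL (λ u → inV u c * ⟦ does (x ≟T (x₀ [ c ]≔ u)) ⟧) (allFin N) ∎
      where
      open ≡-Reasoning
      both = transversal? x ×-dec (s ≟S face x c)
      -- x = x₀[c := u] forces u = x_c
      at-u : ∀ u → ⟦ does (x ≟T (x₀ [ c ]≔ u)) ⟧ ≡ ⟦ does (u F.≟ lookup x c) ⟧ * ⟦ does (x ≟T (x₀ [ c ]≔ lookup x c)) ⟧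
      at-u u = ⟦⟧-× (x ≟T (x₀ [ c ]≔ u)) (u F.≟ lookup x c) (x ≟T (x₀ [ c ]≔ lookup x c))
        (λ { refl → sym (VP.lookup∘update c x₀ u) , cong (x₀ [ c ]≔_) (sym (VP.lookup∘update c x₀ u)) })
        (λ { refl e → e })
      only-xc : ∀ u → ⟦ does (u F.≟ lookup x c) ⟧ * (inV u c * ⟦ does (x ≟T (x₀ [ c ]≔ lookup x c)) ⟧)
                    ≡ inV u c * ⟦ does (x ≟T (x₀ [ c ]≔ u)) ⟧
      only-xc u = trans (*-left-comm ⟦ does (u F.≟ lookup x c) ⟧ (inV u c) _) (cong (inV u c *_) (sym (at-u u)))
        where
        *-left-comm : ∀ a b z → a * (b * z) ≡ b * (a * z)
        *-left-comm = solve-∀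

    fibre-size : sumL (λ x → T x * ⟦ does (s ≟S face x c) ⟧) tuples ≡ size c
    fibre-size = begin
        sumL (λ x → T x * ⟦ does (s ≟S face x c) ⟧) tuples
      ≡⟨ sumL-cong fibre-indicator tuples ⟩
        sumL (λ x → sumL (λ u → inV u c * ⟦ does (x ≟T (x₀ [ c ]≔ u)) ⟧) (allFin N)) tuples
      ≡⟨ sumL-swap _ tuples (allFin N) ⟩
        sumL (λ u → sumL (λ x → inV u c * ⟦ does (x ≟T (x₀ [ c ]≔ u)) ⟧) tuples) (allFin N)
      ≡⟨ sumL-cong (λ u → trans (sumL-*ˡ (inV u c) _ tuples) (cong (inV u c *_) (allVecs-once F._≟_ (allFin-once N) (suc r) (x₀ [ c ]≔ u)))) (allFin N) ⟩
        sumL (λ u → inV u c * 1) (allFin N)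
      ≡⟨ trans (sumL-cong (λ u → *-identityʳ (inV u c)) (allFin N)) (sym (classSize≡sum c)) ⟩
        size c ∎
      where open ≡-Reasoning

  face-count : ∀ c → NonZero (size c) → sumL (λ x → T x * E c x) tuples ≡ size c * edgesP G c
  face-count c nonempty = begin
      sumL (λ x → T x * E c x) tuples
    ≡⟨ sumL-cong (λ x → ⟦⟧-*-cong (transversal? x) (as-sum x)) tuples ⟩
      sumL (λ x → T x * sumL (λ s → ⟦ does (s ≟S face x c) ⟧ * W s) subsets) tuples
    ≡⟨ sumL-cong (λ x → sym (sumL-*ˡ (T x) _ subsets)) tuples ⟩
      sumL (λ x → sumL (λ s → T x * (⟦ does (s ≟S face x c) ⟧ * W s)) subsets) tuples
    ≡⟨ sumL-swap _ tuples subsets ⟩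
      sumL (λ s → sumL (λ x → T x * (⟦ does (s ≟S face x c) ⟧ * W s)) tuples) subsets
    ≡⟨ sumL-cong (λ s → trans (sumL-cong (λ x → sym (*-assoc (T x) _ (W s))) tuples) (sumL-*ʳ (W s) _ tuples)) subsets ⟩
      sumL (λ s → sumL (λ x → T x * ⟦ does (s ≟S face x c) ⟧) tuples * W s) subsets
    ≡⟨ sumL-cong (λ s → on-edges s (edge s ∧ avoids? G s c) refl) subsets ⟩
      sumL (λ s → size c * W s) subsets
    ≡⟨ sumL-*ˡ (size c) W subsets ⟩
      size c * sumL W subsets
    ≡⟨ cong (size c *_) (sym (countL≡sumL (λ e → edge e ∧ avoids? G e c) subsets)) ⟩
      size c * edgesP G c ∎
    where
    open ≡-Reasoning
    subsets = allSubsets N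
    W : Subset N → ℕ
    W s = ⟦ edge s ∧ avoids? G s c ⟧
    u₀ = class-witness c nonempty
    as-sum : ∀ x → IsTransversal x → E c x ≡ sumL (λ s → ⟦ does (s ≟S face x c) ⟧ * W s) subsets
    as-sum x t = sym (trans (sum-pick _≟S_ {subsets} (allSubsets-once N) W (face x c))
      (cong ⟦_⟧ (trans (cong (edge (face x c) ∧_) (avoids?-complete (face x c) c (face-misses x c t))) (BP.∧-identityʳ _))))
    on-edges : ∀ s b → edge s ∧ avoids? G s c ≡ b →
      sumL (λ x → T x * ⟦ does (s ≟S face x c) ⟧) tuples * ⟦ b ⟧ ≡ size c * ⟦ b ⟧
    on-edges s false _ = trans (*-zeroʳ (sumL (λ x → T x * ⟦ does (s ≟S face x c) ⟧) tuples)) (sym (*-zeroʳ (size c)))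
    on-edges s true  h = let (es , av) = ∧-true _ _ h in
      cong (_* 1) (Completion.fibre-size s c es (avoids?-sound s c av) (proj₁ u₀) (proj₂ u₀))

-- For a transversal x and classes i ≠ j, the
-- ridge x − {x_i, x_j} is a partite (r−1)-set missing V_i and V_j, and
-- D_ij(x) = Σ_{u ∈ V_i} E_j(x with x_i := u) is its degree into V_i.
module Ridges {r : ℕ} (G : PartiteGraph r) (balanced : StrictlyBalanced G) where
  open PartiteGraph G
  open Transversals G
  open Faces G

  ridge : Tuple → Fin (suc r) → Fin (suc r) → Subset N
  ridge x i j = image (lookup x) (∁ ⁅ i ⁆ ∩ ∁ ⁅ j ⁆)

  ridge-sym : ∀ x i j → ridge x i j ≡ ridge x j i
  ridge-sym x i j = cong (image (lookup x)) (vec-ext (∁ ⁅ i ⁆ ∩ ∁ ⁅ j ⁆) (∁ ⁅ j ⁆ ∩ ∁ ⁅ i ⁆) (λ a →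
    trans (lookup-∩ (∁ ⁅ i ⁆) (∁ ⁅ j ⁆) a) (trans (BP.∧-comm (lookup (∁ ⁅ i ⁆) a) _) (sym (lookup-∩ (∁ ⁅ j ⁆) (∁ ⁅ i ⁆) a)))))

  ridge-⇒ : ∀ x i j v → lookup (ridge x i j) v ≡ true → Σ (Fin (suc r)) λ a → a ≢ i × a ≢ j × lookup x a ≡ v
  ridge-⇒ x i j v h =
    let (a , p , q) = image-⇒ (lookup x) (∁ ⁅ i ⁆ ∩ ∁ ⁅ j ⁆) v h
        (a∉i , a∉j) = ∧-true _ _ (trans (sym (lookup-∩ (∁ ⁅ i ⁆) (∁ ⁅ j ⁆) a)) p)
    in a , ∁⁅⁆-true⁻ i a a∉i , ∁⁅⁆-true⁻ j a a∉j , q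

  ridge-⇐ : ∀ x i j a → a ≢ i → a ≢ j → lookup (ridge x i j) (lookup x a) ≡ true
  ridge-⇐ x i j a a≢i a≢j = image-⇐ (lookup x) (∁ ⁅ i ⁆ ∩ ∁ ⁅ j ⁆) a
    (trans (lookup-∩ (∁ ⁅ i ⁆) (∁ ⁅ j ⁆) a) (cong₂ _∧_ (∁⁅⁆-true i a a≢i) (∁⁅⁆-true j a a≢j)))

  ridge-misses : ∀ x i j → IsTransversal x → ∀ {c} → c ≡ i ⊎ c ≡ j → Misses (ridge x i j) c
  ridge-misses x i j t c∈ij v h cv with ridge-⇒ x i j v h
  ... | a , a≢i , a≢j , e with c∈ij
  ...   | inj₁ refl = a≢i (trans (sym (t a)) (trans (cong cls e) cv))
  ...   | inj₂ refl = a≢j (trans (sym (t a)) (trans (cong cls e) cv))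

  face-update : ∀ x i j u → i ≢ j → face (x [ i ]≔ u) j ≡ ridge x i j ∪ ⁅ u ⁆
  face-update x i j u i≢j = subset-ext _ _ ⊆ ⊇
    where
    ⊆ : ∀ v → lookup (face (x [ i ]≔ u) j) v ≡ true → lookup (ridge x i j ∪ ⁅ u ⁆) v ≡ true
    ⊆ v h with face-⇒ (x [ i ]≔ u) j v h
    ... | a , a≢j , e with a F.≟ i
    ...   | yes refl = trans (lookup-∪ (ridge x i j) ⁅ u ⁆ v) (trans (cong (lookup (ridge x i j) v ∨_)
                         (trans (lookup-⁅⁆ u v) (dec-true⁻ (v F.≟ u) (trans (sym e) (VP.lookup∘update a x u))))) (BP.∨-zeroʳ _))
    ...   | no a≢i   = trans (lookup-∪ (ridge x i j) ⁅ u ⁆ v) (cong (_∨ lookup ⁅ u ⁆ v)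
                         (subst (λ w → lookup (ridge x i j) w ≡ true) (trans (sym (VP.lookup∘update′ a≢i x u)) e) (ridge-⇐ x i j a a≢i a≢j)))
    ⊇ : ∀ v → lookup (ridge x i j ∪ ⁅ u ⁆) v ≡ true → lookup (face (x [ i ]≔ u) j) v ≡ true
    ⊇ v h with ∨-true _ _ (trans (sym (lookup-∪ (ridge x i j) ⁅ u ⁆ v)) h)
    ... | inj₁ p = let (a , a≢i , a≢j , e) = ridge-⇒ x i j v p in
          subst (λ w → lookup (face (x [ i ]≔ u) j) w ≡ true) (trans (VP.lookup∘update′ a≢i x u) e) (face-⇐ (x [ i ]≔ u) j a a≢j)
    ... | inj₂ p = subst (λ w → lookup (face (x [ i ]≔ u) j) w ≡ true) (trans (VP.lookup∘update i x u) (sym (lookup-⁅⁆-true u v p)))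
                     (face-⇐ (x [ i ]≔ u) j i i≢j)

  -- The face opposite c does not see x_c.
  face-update-same : ∀ x c w → face (x [ c ]≔ w) c ≡ face x c
  face-update-same x c w = subset-ext _ _ (λ v h → moved x (x [ c ]≔ w) (λ a a≢c → sym (VP.lookup∘update′ a≢c x w)) v h)
                                        (λ v h → moved (x [ c ]≔ w) x (λ a a≢c → VP.lookup∘update′ a≢c x w) v h)
    where
    moved : ∀ y z → (∀ a → a ≢ c → lookup y a ≡ lookup z a) → ∀ v → lookup (face z c) v ≡ true → lookup (face y c) v ≡ true
    moved y z y≗z v h = let (a , a≢c , e) = face-⇒ z c v h in
      subst (λ t → lookup (face y c) t ≡ true) (trans (y≗z a a≢c) e) (face-⇐ y c a a≢c)

  D : Fin (suc r) → Fin (suc r) → Tuple → ℕ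
  D i j = resampled i (E j)

  D≡deg : ∀ x i j → i ≢ j → D i j x ≡ deg G i (ridge x i j)
  D≡deg x i j i≢j = sym (trans (countL≡sumL (λ v → inClass G v i ∧ edge (ridge x i j ∪ ⁅ v ⁆)) (allFin N))
    (sumL-cong (λ u → trans (⟦∧⟧ (inClass G u i) _) (cong (λ z → inV u i * ⟦ edge z ⟧) (sym (face-update x i j u i≢j)))) (allFin N)))

  -- If some v ∈ V_i extends g (missing V_i) to an edge, then g is a partite
  -- (r−1)-set, so the balance hypothesis applies to g.
  extendable⇒ridge : ∀ g i v → Misses g i → cls v ≡ i → edge (g ∪ ⁅ v ⁆) ≡ true → S.∣ g ∣ ≡ r ∸ 1 × IsPartite G g
  extendable⇒ridge g i v misses cv es = size-g , partite-g
    where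
    v∉g : lookup g v ≡ false
    v∉g with lookup g v in gv
    ... | false = refl
    ... | true  = ⊥-elim (misses v gv cv)
    size-g : S.∣ g ∣ ≡ r ∸ 1
    size-g = begin
      S.∣ g ∣                ≡⟨ sym (m+n∸n≡m _ 1) ⟩
      S.∣ g ∣ + 1 ∸ 1        ≡⟨ cong (_∸ 1) (sym (size-∪-⁅⁆ g v v∉g)) ⟩
      S.∣ g ∪ ⁅ v ⁆ ∣ ∸ 1    ≡⟨ cong (_∸ 1) (uniform _ es) ⟩
      r ∸ 1                  ∎
      where open ≡-Reasoning
    in-union : ∀ {a} → a ∈ g → a ∈ g ∪ ⁅ v ⁆
    in-union a∈g = lookup⇒∈ (trans (lookup-∪ g ⁅ v ⁆ _) (cong (_∨ _) (∈⇒lookup a∈g)))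
    partite-g : IsPartite G g
    partite-g a b a∈g b∈g = partite _ es a b (in-union a∈g) (in-union b∈g)

  degree-witness : ∀ i g → 0 N.< deg G i g → Σ (Fin N) λ v → cls v ≡ i × edge (g ∪ ⁅ v ⁆) ≡ true
  degree-witness i g pos with positive-term _ (allFin N) (subst (0 N.<_) (countL≡sumL (λ v → inClass G v i ∧ edge (g ∪ ⁅ v ⁆)) (allFin N)) pos)
  ... | v , p = v , extends p
    where
    extends : 0 N.< ⟦ inClass G v i ∧ edge (g ∪ ⁅ v ⁆) ⟧ → cls v ≡ i × edge (g ∪ ⁅ v ⁆) ≡ true
    extends p with cls v F.≟ i | edge (g ∪ ⁅ v ⁆)
    ... | yes cv | true = cv , refl

  -- The balance condition: D_ij(x) = D_ji(x) on transversals.  (If both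
  -- degrees vanish there is nothing to show; otherwise an extension to an edge
  -- shows the ridge satisfies the hypotheses of StrictlyBalanced.)
  balance : ∀ x i j → IsTransversal x → i ≢ j → D i j x ≡ D j i x
  balance x i j t i≢j = begin
      D i j x               ≡⟨ D≡deg x i j i≢j ⟩
      deg G i g             ≡⟨ equal-degrees ⟩
      deg G j g             ≡⟨ cong (deg G j) (ridge-sym x i j) ⟩
      deg G j (ridge x j i) ≡⟨ sym (D≡deg x j i (λ e → i≢j (sym e))) ⟩
      D j i x               ∎
    where
    open ≡-Reasoning
    g = ridge x i j
    misses-i = ridge-misses x i j t (inj₁ refl)
    misses-j = ridge-misses x i j t (inj₂ refl)
    avoids : ∀ {c} → Misses g c → Avoids G g c
    avoids misses v v∈g = misses v (∈⇒lookup v∈g)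
    from-ridge : S.∣ g ∣ ≡ r ∸ 1 × IsPartite G g → deg G i g ≡ deg G j g
    from-ridge (size-g , partite-g) = balanced g size-g partite-g i j (avoids misses-i) (avoids misses-j)
    equal-degrees : deg G i g ≡ deg G j g
    equal-degrees with 0 N.<? deg G i g | 0 N.<? deg G j g
    ... | yes pos | _ = let (v , cv , ev) = degree-witness i g pos in from-ridge (extendable⇒ridge g i v misses-i cv ev)
    ... | no _ | yes pos = let (v , cv , ev) = degree-witness j g pos in from-ridge (extendable⇒ridge g j v misses-j cv ev)
    ... | no zi | no zj = trans (n≤0⇒n≡0 (≮⇒≥ zi)) (sym (n≤0⇒n≡0 (≮⇒≥ zj)))

-- Double counting D_ij gives |E(P_i)| = |E(P_j)|, and
-- Cauchy–Schwarz applied to D_ij bounds from below the number of transversals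
-- both of whose faces opposite i and j are edges.
module SecondMoment {r : ℕ} (G : PartiteGraph r) (nonempty : ∀ i → NonZero (classSize G i))
                    (balanced : StrictlyBalanced G) where
  open PartiteGraph G
  open Transversals G
  open Faces G
  open FaceCounting G
  open Ridges G balanced

  e : Fin (suc r) → ℕ
  e c = edgesP G c

  pairs : Fin (suc r) → Fin (suc r) → ℕ
  pairs i j = sumL (λ x → T x * (E j x * E i x)) tuples

  size²-nonZero : ∀ i j → NonZero (size i * size j)
  size²-nonZero i j = m*n≢0 (size i) (size j) {{nonempty i}} {{nonempty j}}

  D-sum : ∀ i j → sumL (λ x → T x * D i j x) tuples ≡ size i * (size j * e j)
  D-sum i j = trans (resample i (E j) (D i j) (λ x t → refl)) (cong (size i *_) (face-count j (nonempty j)))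

  edges-equal : ∀ i j → i ≢ j → e i ≡ e j
  edges-equal i j i≢j = sym (*-cancelˡ-≡ (e j) (e i) (size i * size j) {{size²-nonZero i j}} (begin
      (size i * size j) * e j
    ≡⟨ *-assoc (size i) (size j) (e j) ⟩
      size i * (size j * e j)
    ≡⟨ sym (D-sum i j) ⟩
      sumL (λ x → T x * D i j x) tuples
    ≡⟨ sumL-cong (λ x → ⟦⟧-*-cong (transversal? x) (λ t → balance x i j t i≢j)) tuples ⟩
      sumL (λ x → T x * D j i x) tuples
    ≡⟨ D-sum j i ⟩
      size j * (size i * e i)
    ≡⟨ reorder (size j) (size i) (e i) ⟩
      (size i * size j) * e i ∎))
    where
    open ≡-Reasoning
    reorder : ∀ a b c → a * (b * c) ≡ (b * a) * c
    reorder = solve-∀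

  -- Σ_x T D_ij² = |V_i| |V_j| pairs(i, j): resample i, then (by balance) j.
  D²-sum : ∀ i j → i ≢ j → sumL (λ x → T x * (D i j x * D i j x)) tuples ≡ size i * (size j * pairs i j)
  D²-sum i j i≢j = trans (resample i (λ x → E j x * D i j x) (λ x → D i j x * D i j x) resample-i)
                         (cong (size i *_) (resample j (λ x → E j x * E i x) (λ x → E j x * D i j x) resample-j))
    where
    D-update : ∀ x u → D i j (x [ i ]≔ u) ≡ D i j x
    D-update x u = sumL-cong (λ u′ → cong (λ z → inV u′ i * E j z) (VP.[]≔-idempotent x i)) (allFin N)
    resample-i : ∀ x → IsTransversal x → D i j x * D i j x ≡ sumL (λ u → inV u i * (E j (x [ i ]≔ u) * D i j (x [ i ]≔ u))) (allFin N)
    resample-i x t = sym (trans (sumL-cong (λ u → trans (cong (λ z → inV u i * (E j (x [ i ]≔ u) * z)) (D-update x u)) (sym (*-assoc (inV u i) _ _))) (allFin N))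
                                (sumL-*ʳ (D i j x) (λ u → inV u i * E j (x [ i ]≔ u)) (allFin N)))
    resample-j : ∀ x → IsTransversal x → E j x * D i j x ≡ sumL (λ w → inV w j * (E j (x [ j ]≔ w) * E i (x [ j ]≔ w))) (allFin N)
    resample-j x t = sym (begin
        sumL (λ w → inV w j * (E j (x [ j ]≔ w) * E i (x [ j ]≔ w))) (allFin N)
      ≡⟨ sumL-cong (λ w → trans (cong (λ z → inV w j * (⟦ edge z ⟧ * E i (x [ j ]≔ w))) (face-update-same x j w)) (*-left-comm (inV w j) (E j x) _)) (allFin N) ⟩
        sumL (λ w → E j x * (inV w j * E i (x [ j ]≔ w))) (allFin N)
      ≡⟨ sumL-*ˡ (E j x) _ (allFin N) ⟩
        E j x * D j i x
      ≡⟨ cong (E j x *_) (sym (balance x i j t i≢j)) ⟩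
        E j x * D i j x ∎)
      where
      open ≡-Reasoning
      *-left-comm : ∀ a b c → a * (b * c) ≡ b * (a * c)
      *-left-comm = solve-∀

  -- Cauchy–Schwarz: (Σ T D_ij)² ≤ (Σ T)(Σ T D_ij²), i.e.
  -- |V_i| |V_j| e_j² ≤ Π_c |V_c| · pairs(i, j).
  pairs-bound : ∀ i j → i ≢ j → (size i * size j) * (e j * e j) ≤ volume * pairs i j
  pairs-bound i j i≢j = *-cancelˡ-≤ (size i * size j) {{size²-nonZero i j}} (begin
      (size i * size j) * ((size i * size j) * (e j * e j))
    ≡⟨ square (size i) (size j) (e j) ⟩
      (size i * (size j * e j)) * (size i * (size j * e j))
    ≡⟨ cong (λ z → z * z) (sym (trans (sumL-cong (λ x → T²-absorb x (D i j x)) tuples) (D-sum i j))) ⟩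
      sumL (λ x → T x * (T x * D i j x)) tuples * sumL (λ x → T x * (T x * D i j x)) tuples
    ≤⟨ cauchy-schwarz T (λ x → T x * D i j x) tuples ⟩
      sumL (λ x → T x * T x) tuples * sumL (λ x → (T x * D i j x) * (T x * D i j x)) tuples
    ≡⟨ cong₂ _*_ (trans (sumL-cong (λ x → ⟦⟧² (does (transversal? x))) tuples) transversal-count)
                 (sumL-cong (λ x → trans (distribute (T x) (D i j x)) (T²-absorb x _)) tuples) ⟩
      volume * sumL (λ x → T x * (D i j x * D i j x)) tuples
    ≡⟨ cong (volume *_) (D²-sum i j i≢j) ⟩
      volume * (size i * (size j * pairs i j))
    ≡⟨ rearrange volume (size i) (size j) (pairs i j) ⟩
      (size i * size j) * (volume * pairs i j) ∎)
    where
    open ≤-Reasoning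
    T²-absorb : ∀ x a → T x * (T x * a) ≡ T x * a
    T²-absorb x a = trans (sym (*-assoc (T x) (T x) a)) (cong (_* a) (⟦⟧² (does (transversal? x))))
    square : ∀ a b c → (a * b) * ((a * b) * (c * c)) ≡ (a * (b * c)) * (a * (b * c))
    square = solve-∀
    distribute : ∀ t a → (t * a) * (t * a) ≡ t * (t * (a * a))
    distribute = solve-∀
    rearrange : ∀ p a b s → p * (a * (b * s)) ≡ (a * b) * (p * s)
    rearrange = solve-∀

-- Writing M = Σ_{i≠j} |E(P_i)| |V_i| (so that Σ_{i≠j} ρ(i) =
-- M / Π_c |V_c|), the pair bound gives |V_j| e_j M ≤ Π_c |V_c| Σ_{i≠j} pairs(i, j).
-- If M > m Π_c |V_c| then some transversal x with E_j(x) = 1 has more than m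
-- further faces in G, hence at most r − m − 1 missing faces.
module Averaging {r : ℕ} (G : PartiteGraph r) (nonempty : ∀ i → NonZero (classSize G i))
                 (balanced : StrictlyBalanced G) where
  open PartiteGraph G
  open Transversals G
  open Faces G
  open FaceCounting G
  open SecondMoment G nonempty balanced

  missing : Tuple → ℕ
  missing x = sumL (λ c → ⟦ not (edge (face x c)) ⟧) (allFin (suc r))

  -- Σ_x T x E_j(x) Σ_{i≠j} E_i(x), counted by the pairs it contains.
  co-faces : Fin (suc r) → ℕ
  co-faces j = sumL (λ x → T x * (E j x * sumL (λ i → E i x) (except j (allFin (suc r))))) tuples

  co-faces-bound : ∀ j → (size j * e j) * weight j ≤ volume * co-faces j
  co-faces-bound j = begin
      (size j * e j) * weight j
    ≡⟨ sym (sumL-*ˡ (size j * e j) _ others) ⟩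
      sumL (λ i → (size j * e j) * (e i * size i)) others
    ≡⟨ sum-except j _ (allFin (suc r)) ⟩
      sumL (λ i → ⟦ not (does (i F.≟ j)) ⟧ * ((size j * e j) * (e i * size i))) (allFin (suc r))
    ≤⟨ sumL-mono termwise (allFin (suc r)) ⟩
      sumL (λ i → ⟦ not (does (i F.≟ j)) ⟧ * (volume * pairs i j)) (allFin (suc r))
    ≡⟨ sym (sum-except j _ (allFin (suc r))) ⟩
      sumL (λ i → volume * pairs i j) others
    ≡⟨ sumL-*ˡ volume _ others ⟩
      volume * sumL (λ i → pairs i j) others
    ≡⟨ cong (volume *_) (sym as-pairs) ⟩
      volume * co-faces j ∎
    where
    open ≤-Reasoning
    others = except j (allFin (suc r))
    as-pairs : co-faces j ≡ sumL (λ i → pairs i j) others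
    as-pairs = trans (sumL-cong (λ x → trans (cong (T x *_) (sym (sumL-*ˡ (E j x) (λ i → E i x) others))) (sym (sumL-*ˡ (T x) _ others))) tuples)
                     (sumL-swap (λ x i → T x * (E j x * E i x)) tuples others)
    reorder : ∀ a b c → (b * c) * (c * a) ≡ (a * b) * (c * c)
    reorder = solve-∀
    termwise : ∀ i → ⟦ not (does (i F.≟ j)) ⟧ * ((size j * e j) * (e i * size i)) ≤ ⟦ not (does (i F.≟ j)) ⟧ * (volume * pairs i j)
    termwise i with i F.≟ j
    ... | yes _   = z≤n
    ... | no i≢j  = +-monoˡ-≤ 0 (≤-trans (≤-reflexive (trans (cong (λ z → (size j * e j) * (z * size i)) (edges-equal i j i≢j))
                                                            (reorder (size i) (size j) (e j))))
                                        (pairs-bound i j i≢j))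

  -- If the weight exceeds m Π_c |V_c|, then e_j > 0 (all e_i are equal).
  e-nonZero : ∀ m j → m * volume N.< weight j → NonZero (e j)
  e-nonZero m j big with e j in ej
  ... | suc _ = _
  ... | zero  = ⊥-elim (<⇒≱ big (subst (_≤ m * volume) (sym weight-zero) z≤n))
    where
    weight-zero : weight j ≡ 0
    weight-zero = trans (sum-except j _ (allFin (suc r))) (trans (sumL-cong vanish (allFin (suc r))) (sumL-zero (allFin (suc r))))
      where
      vanish : ∀ i → ⟦ not (does (i F.≟ j)) ⟧ * (e i * size i) ≡ 0
      vanish i with i F.≟ j
      ... | yes _  = refl
      ... | no i≢j = trans (+-identityʳ _) (cong (_* size i) (trans (edges-equal i j i≢j) ej))

  averaged : ∀ m j → m * volume N.< weight j →
    sumL (λ x → T x * E j x * m) tuples N.< co-faces j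
  averaged m j big = subst (N._< co-faces j) (sym (trans (sumL-*ʳ m (λ x → T x * E j x) tuples) (cong (_* m) (face-count j (nonempty j)))))
    (*-cancelˡ-< volume _ _ (begin-strict
        volume * ((size j * e j) * m)
      ≡⟨ reorder (size j * e j) m volume ⟩
        (size j * e j) * (m * volume)
      <⟨ *-monoʳ-< (size j * e j) {{m*n≢0 (size j) (e j) {{nonempty j}} {{e-nonZero m j big}}}} big ⟩
        (size j * e j) * weight j
      ≤⟨ co-faces-bound j ⟩
        volume * co-faces j ∎))
    where
    open ≤-Reasoning
    reorder : ∀ a m p → p * (a * m) ≡ a * (m * p)
    reorder = solve-∀

  few-missing : ∀ k j x → E j x ≡ 1 → r ∸ k ∸ 1 N.< sumL (λ i → E i x) (except j (allFin (suc r))) → missing x ≤ k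
  few-missing k j x Ej≡1 many = +-cancelˡ-≤ present _ _ (begin
      present + missing x   ≡⟨ all-faces ⟩
      suc r                 ≤⟨ r+1≤k+[r∸k∸1]+2 ⟩
      k + suc (suc (r ∸ k ∸ 1)) ≤⟨ +-monoʳ-≤ k (≤-trans (s≤s many) (≤-reflexive (sym present-split))) ⟩
      k + present           ≡⟨ +-comm k present ⟩
      present + k           ∎)
    where
    open ≤-Reasoning
    present = sumL (λ c → E c x) (allFin (suc r))
    present-split : present ≡ suc (sumL (λ i → E i x) (except j (allFin (suc r))))
    present-split = trans (sum-split (suc r) j (λ c → E c x)) (cong (_+ sumL (λ i → E i x) (except j (allFin (suc r)))) Ej≡1)
    all-faces : present + missing x ≡ suc r
    all-faces = trans (sym (sumL-+ (λ c → E c x) (λ c → ⟦ not (edge (face x c)) ⟧) (allFin (suc r))))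
                      (trans (sumL-cong (λ c → ⟦not⟧ (edge (face x c))) (allFin (suc r))) (sumFin-const (suc r)))
    r+1≤k+[r∸k∸1]+2 : suc r ≤ k + suc (suc (r ∸ k ∸ 1))
    r+1≤k+[r∸k∸1]+2 = ≤-trans (s≤s (≤-trans (m≤n+m∸n r k) (+-monoʳ-≤ k (≤-pred-suc (r ∸ k)))))
                               (≤-reflexive (sym (+-suc k (suc (r ∸ k ∸ 1)))))
      where
      ≤-pred-suc : ∀ n → n ≤ suc (n ∸ 1)
      ≤-pred-suc zero    = z≤n
      ≤-pred-suc (suc n) = s≤s ≤-refl

  good-transversal : ∀ k j → (r ∸ k ∸ 1) * volume N.< weight j → Σ Tuple λ x → IsTransversal x × missing x ≤ k
  good-transversal k j big with larger-term _ (λ x → T x * E j x * (r ∸ k ∸ 1)) tuples (averaged (r ∸ k ∸ 1) j big)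
  ... | x , better with indicators-< (does (transversal? x)) (edge (face x j)) _ _ better
  ...   | is-transversal , is-edge , many =
    x , dec-true (transversal? x) is-transversal , few-missing k j x (cong ⟦_⟧ is-edge) many

-- A transversal with at most k missing faces contains K_{r+1}^r − k: arrange
-- its coordinates so that the missing faces are opposite the first k
-- vertices of K_{r+1}^r, whose opposite edges are exactly the deleted ones.
module Embedding {r : ℕ} (G : PartiteGraph r) where
  open PartiteGraph G
  open Transversals G
  open Faces G

  embed : ∀ k x → IsTransversal x → sumL (λ c → ⟦ not (edge (face x c)) ⟧) (allFin (suc r)) ≤ k → ContainsKminus G k
  embed k x t few = f , (λ {a} {b} → f-injective a b) , edges
    where
    A = arrange (suc r) (λ c → edge (face x c)) k few
    open Arrangement A
    f : Fin (suc r) → Fin N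
    f m = lookup x (σ m)
    f-injective : ∀ a b → f a ≡ f b → a ≡ b
    f-injective a b fa≡fb = injective (trans (sym (t (σ a))) (trans (cong cls fa≡fb) (t (σ b))))
    image-face : ∀ m → image f (∁ ⁅ m ⁆) ≡ face x (σ m)
    image-face m = subset-ext _ _ ⊆ ⊇
      where
      ⊆ : ∀ v → lookup (image f (∁ ⁅ m ⁆)) v ≡ true → lookup (face x (σ m)) v ≡ true
      ⊆ v h = let (a , a≢m , fa≡v) = image-⇒ f (∁ ⁅ m ⁆) v h in
        subst (λ w → lookup (face x (σ m)) w ≡ true) fa≡v (face-⇐ x (σ m) (σ a) (λ e → ∁⁅⁆-true⁻ m a a≢m (injective e)))
      ⊇ : ∀ v → lookup (face x (σ m)) v ≡ true → lookup (image f (∁ ⁅ m ⁆)) v ≡ true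
      ⊇ v h with face-⇒ x (σ m) v h
      ... | c , c≢σm , xc≡v with injective⇒surjective σ injective c
      ...   | a , σa≡c = subst (λ w → lookup (image f (∁ ⁅ m ⁆)) w ≡ true) (trans (cong (lookup x) σa≡c) xc≡v)
                           (image-⇐ f (∁ ⁅ m ⁆) a (∁⁅⁆-true m a (λ a≡m → c≢σm (trans (sym σa≡c) (cong σ a≡m)))))
    edges : ∀ e → KminusEdge r k e → edge (image f e) ≡ true
    edges e (m , k≤m , refl) = trans (cong edge (image-face m)) (late-good m k≤m)

-- From the rational hypothesis to naturals: with P = Π_c |V_c| we have
-- Σ_{i≠j} ρ(i) = (Σ_{i≠j} |E(P_i)| |V_i|) / P, since ∏_{c≠i} |V_c| · |V_i| = P.
module Rationals {r : ℕ} (G : PartiteGraph r) (nonempty : ∀ i → NonZero (classSize G i)) where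
  open Transversals G

  -- a / Q = a c / P whenever P = c Q (P written as suc d).
  ÷ℕ-rescale : ∀ a Q c d → .{{_ : NonZero Q}} → suc d ≡ c * Q → toℚᵘ (a ÷ℕ Q) U.≃ mkℚᵘ (+ (a * c)) d
  ÷ℕ-rescale a (suc q) c d P≡cQ = UP.≃-trans (QP.toℚᵘ-fromℚᵘ (mkℚᵘ (+ a) q))
    (*≡* (trans (sym (ZP.pos-* a (suc d))) (trans (cong +_ cross) (ZP.pos-* (a * c) (suc q)))))
    where
    cross : a * suc d ≡ (a * c) * suc q
    cross = trans (cong (a *_) P≡cQ) (sym (*-assoc a c (suc q)))

  add-same-denominator : ∀ a b d → mkℚᵘ (+ a) d U.+ mkℚᵘ (+ b) d U.≃ mkℚᵘ (+ (a + b)) d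
  add-same-denominator a b d = *≡* (trans (factor (+ a) (+ b) (+ suc d)) (sym (cong₂ Z._*_ (ZP.pos-+ a b) (ZP.pos-* (suc d) (suc d)))))
    where
    factor : ∀ A B X → (A Z.* X Z.+ B Z.* X) Z.* X ≡ (A Z.+ B) Z.* (X Z.* X)
    factor = ZR.solve-∀

  sumρ≃ : ∀ d → volume ≡ suc d → ∀ (L : List (Fin (suc r))) →
    toℚᵘ (sumℚ (map (ρ G) L)) U.≃ mkℚᵘ (+ sumL (λ i → edgesP G i * size i) L) d
  sumρ≃ d P≡ []      = *≡* refl
  sumρ≃ d P≡ (i ∷ L) = UP.≃-trans (QP.toℚᵘ-homo-+ (ρ G i) (sumℚ (map (ρ G) L)))
    (UP.≃-trans (UP.+-cong (÷ℕ-rescale (edgesP G i) (prodOthers G i) (size i) d {{others-nonZero}} P≡split) (sumρ≃ d P≡ L))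
      (add-same-denominator (edgesP G i * size i) _ d))
    where
    others-nonZero = prodL-nonZero size nonempty (except i (allFin (suc r)))
    P≡split : suc d ≡ size i * prodOthers G i
    P≡split = trans (sym P≡) (prod-split (suc r) i size)

  from-ℚ : ∀ m j → (+ m) / 1 < sumρExcept G j → m * volume N.< weight j
  from-ℚ m j m<Σρ = by-volume volume refl
    where
    by-volume : ∀ P → volume ≡ P → m * volume N.< weight j
    by-volume zero    P≡0 = ⊥-elim (N.≢-nonZero⁻¹ volume {{volume-nonZero nonempty}} P≡0)
    by-volume (suc d) P≡  = subst (λ P → m * P N.< weight j) (sym P≡)
      (subst (m * suc d N.<_) (*-identityʳ (weight j)) (drop (subst₂ Z._<_ (sym (ZP.pos-* m (suc d))) (sym (ZP.pos-* (weight j) 1)) cross)))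
      where
      drop : ∀ {a b} → + a Z.< + b → a N.< b
      drop (+<+ a<b) = a<b
      in-ℚᵘ : mkℚᵘ (+ m) 0 U.< mkℚᵘ (+ weight j) d
      in-ℚᵘ = UP.<-respʳ-≃ (sumρ≃ d P≡ (except j (allFin (suc r))))
                (UP.<-respˡ-≃ (QP.toℚᵘ-fromℚᵘ (mkℚᵘ (+ m) 0)) (QP.toℚᵘ-mono-< m<Σρ))
      cross : + m Z.* + suc d Z.< + weight j Z.* + 1
      cross with in-ℚᵘ
      ... | *<* lt = lt

-- Theorem 3.7.
theorem3p7 : (r k : ℕ) → 2 ≤ r → k ≤ r ∸ 1 → (G : PartiteGraph r)
    → (∀ i → NonZero (classSize G i))
    → StrictlyBalanced G
    → (∃ λ j → (+ (r ∸ k ∸ 1)) / 1 < sumρExcept G j)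
    → ContainsKminus G k
theorem3p7 r k _ _ G nonempty balanced (j , r-k-1<Σρ) =
  let weight-large = Rationals.from-ℚ G nonempty (r ∸ k ∸ 1) j r-k-1<Σρ
      (x , transversal , few-missing) = Averaging.good-transversal G nonempty balanced k j weight-large
  in Embedding.embed G k x transversal few-missing
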